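{- Let $n\ge 2$ be an integer. There exists a linear $PL(n,2)$-code if and only if there exist a finite abelian group $G$ (written multiplicatively, with identity $1$) of order $2n^2+2n+1$ and a subset $T\subseteq G$, viewed as an element of the group ring $\mathbb{Z}[G]$, such that (1) $1\in T$; (2) $T=T^{(-1)}$; (3) $T^2=2G-T^{(2)}+2n$ in $\mathbb{Z}[G]$.
   Context: The Lee sphere of radius $r$ in $\mathbb{Z}^n$ is $S(n,r)=\{x\in\mathbb{Z}^n: |x_1|+\dots+|x_n|\le r\}$. A linear $PL(n,r)$-code (linear perfect $r$-error-correcting Lee code) is a subgroup (lattice) $C\subseteq\mathbb{Z}^n$ such that the translates $\{S(n,r)+c: c\in C\}$ form a partition of $\mathbb{Z}^n$. For a finite group $G$, a subset (or multiset) $A$ of $G$ is identified with the group ring element $\sum_{g\in G}a_g g\in\mathbb{Z}[G]$, where $a_g$ is the multiplicity of $g$ in $A$; in particular $G$ denotes $\sum_{g\in G}g$, and an integer $k$ denotes $k\cdot 1$. For $A=\sum_g a_g g$ and an integer $t$, $A^{(t)}=\sum_g a_g g^t$. Addition and multiplication in $\mathbb{Z}[G]$ are the usual group ring operations. -}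

module Defs where

open import Level using (Level; 0ℓ)
open import Data.Bool using (Bool; true; false; if_then_else_)
open import Data.Nat as ℕ using (ℕ; zero; suc)
open import Data.Integer as ℤ using (ℤ; +_; -[1+_])
open import Data.Fin as Fin using (Fin)
open import Data.Fin.Properties using () renaming (_≟_ to _≟ᶠ_)
open import Data.Product using (Σ; ∃; ∃-syntax; _×_; _,_)
open import Algebra.Structures using (IsAbelianGroup)
open import Function.Bundles using (_↔_; Inverse)
open import Relation.Binary.PropositionalEquality using (_≡_; refl; sym; trans; cong)
open import Relation.Nullary using (Dec; yes; no)
open import Relation.Nullary.Decidable using (map′)

ΣFin : (m : ℕ) → (Fin m → ℤ) → ℤ
ΣFin zero    f = + 0
ΣFin (suc m) f = f Fin.zero ℤ.+ ΣFin m (λ i → f (Fin.suc i))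

ΣFinℕ : (m : ℕ) → (Fin m → ℕ) → ℕ
ΣFinℕ zero    f = 0
ΣFinℕ (suc m) f = f Fin.zero ℕ.+ ΣFinℕ m (λ i → f (Fin.suc i))

ℤ^ : ℕ → Set
ℤ^ n = Fin n → ℤ

leeNorm : ∀ {n} → ℤ^ n → ℕ
leeNorm {n} x = ΣFinℕ n (λ i → ℤ.∣ x i ∣)

_∈S[_] : ∀ {n} → ℤ^ n → ℕ → Set
x ∈S[ r ] = leeNorm x ℕ.≤ r

_⊖_ : ∀ {n} → ℤ^ n → ℤ^ n → ℤ^ n
(x ⊖ y) i = x i ℤ.- y i

_≗ᵥ_ : ∀ {n} → ℤ^ n → ℤ^ n → Set
x ≗ᵥ y = ∀ i → x i ≡ y i

record IsSubgroup (n : ℕ) (C : ℤ^ n → Set) : Set where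
  field
    respects : ∀ {x y} → x ≗ᵥ y → C x → C y
    has-zero : C (λ _ → + 0)
    closed-+ : ∀ {x y} → C x → C y → C (λ i → x i ℤ.+ y i)
    closed-- : ∀ {x} → C x → C (λ i → ℤ.- x i)

-- {S(n,r) + c : c ∈ C} is a partition of ℤ^n: every x lies in
-- S(n,r) + c for some c ∈ C, and this c is unique.
record IsLinearPLCode (n r : ℕ) (C : ℤ^ n → Set) : Set where
  field
    subgroup : IsSubgroup n C
    cover    : ∀ x → ∃[ c ] (C c × (x ⊖ c) ∈S[ r ])
    disjoint : ∀ x c c′ → C c → C c′ → (x ⊖ c) ∈S[ r ] → (x ⊖ c′) ∈S[ r ] → c ≗ᵥ c′

record FinAbGroup : Set₁ where
  field
    Carrier        : Set
    _∙_            : Carrier → Carrier → Carrier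
    ε              : Carrier
    _⁻¹            : Carrier → Carrier
    isAbelianGroup : IsAbelianGroup _≡_ _∙_ ε _⁻¹
    order          : ℕ
    enum           : Carrier ↔ Fin order

  open Inverse enum public using (to; from; strictlyInverseʳ)

  _≟_ : (x y : Carrier) → Dec (x ≡ y)
  x ≟ y = map′ (λ e → trans (sym (strictlyInverseʳ x))
                         (trans (cong from e) (strictlyInverseʳ y)))
               (cong to) (to x ≟ᶠ to y)

  _^ℕ_ : Carrier → ℕ → Carrier
  g ^ℕ zero  = ε
  g ^ℕ suc k = g ∙ (g ^ℕ k)

  _^_ : Carrier → ℤ → Carrier
  g ^ (+ k)      = g ^ℕ k
  g ^ (-[1+ k ]) = (g ^ℕ suc k) ⁻¹

  ΣG : (Carrier → ℤ) → ℤ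
  ΣG f = ΣFin order (λ i → f (from i))

  δ : Carrier → Carrier → ℤ
  δ x y with x ≟ y
  ... | yes _ = + 1
  ... | no  _ = + 0

  -- The group ring ℤ[G]: an element Σ a_g g is the coefficient function g ↦ a_g

  ℤ[G] : Set
  ℤ[G] = Carrier → ℤ

  _≈ᴳ_ : ℤ[G] → ℤ[G] → Set
  A ≈ᴳ B = ∀ g → A g ≡ B g

  _+ᴳ_ : ℤ[G] → ℤ[G] → ℤ[G]
  (A +ᴳ B) g = A g ℤ.+ B g

  _-ᴳ_ : ℤ[G] → ℤ[G] → ℤ[G]
  (A -ᴳ B) g = A g ℤ.- B g

  _*ᴳ_ : ℤ[G] → ℤ[G] → ℤ[G]
  (A *ᴳ B) g = ΣG (λ h → A h ℤ.* B ((h ⁻¹) ∙ g))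

  ⟦_⟧ℤ : ℤ → ℤ[G]
  ⟦ k ⟧ℤ g = k ℤ.* δ g ε

  _·ᴳ_ : ℤ → ℤ[G] → ℤ[G]
  (k ·ᴳ A) g = k ℤ.* A g

  wholeG : ℤ[G]
  wholeG _ = + 1

  _⁽_⁾ : ℤ[G] → ℤ → ℤ[G]
  (A ⁽ t ⁾) g = ΣG (λ h → A h ℤ.* δ (h ^ t) g)

  ⟦_⟧ : (Carrier → Bool) → ℤ[G]
  ⟦ T ⟧ g = if T g then + 1 else + 0

-- For g : Fin n → G let φ : ℤⁿ → G be the homomorphism e j ↦ g j, and let
-- T = 1 + Σⱼ (g j + g j⁻¹) ∈ ℤ[G] be the image of S(n,1).  Sorting the products of two
-- elements of T by the coordinates they involve gives T² + T⁽²⁾ = 2·φ(S(n,2)) + 2n, so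
-- condition (3) says exactly that every element of G has a single preimage in S(n,2),
-- i.e. that ker φ is a linear PL(n,2)-code.  A code C gives G = ℤⁿ/C, realised on S(n,2)
-- itself, with g j the class of e j.  Conversely, G has odd order and hence no
-- involutions, so T ∖ {1} splits into n pairs {g, g⁻¹}; one member of each pair gives g.
module Submission where

open import Defs
open import Algebra.Bundles using (AbelianGroup)
open import Algebra.Structures using (IsAbelianGroup)
import Algebra.Properties.AbelianGroup as AbelianGroupProperties
import Algebra.Properties.CommutativeMonoid.Sum as CommutativeMonoidSum
open import Data.Bool using (Bool; true; false; _∧_; if_then_else_)
open import Data.Empty using (⊥-elim)
open import Data.Fin.Permutation using (Permutation; _⟨$⟩ʳ_)
open import Data.Fin using (Fin; zero; suc; toℕ; _↑ˡ_; _↑ʳ_)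
import Data.Fin.Properties as Finₚ
open import Data.Integer as ℤ using (ℤ; +_; -[1+_]; _+_; _*_; -_; _-_; _≤_)
import Data.Integer.Properties as ℤₚ
open import Data.Integer.Tactic.RingSolver using (solve-∀)
open import Data.Nat as ℕ using (ℕ; zero; suc)
import Data.Nat.Properties as ℕₚ
import Data.Nat.Tactic.RingSolver as ℕSolver
open import Data.Product using (Σ; ∃-syntax; _×_; _,_; proj₁; proj₂)
open import Data.Sum using (_⊎_; inj₁; inj₂)
import Data.Sum
open import Data.Sum.Function.Propositional using (_⊎-↔_)
open import Data.Unit using (⊤; tt)
open import Data.Vec.Functional using (_∷_; tail)
open import Function using (_∘_)
open import Function.Bundles using (Inverse; Injection; Equivalence; _↔_; _⇔_; mk⇔; mk↔ₛ′)
open import Function.Properties.Inverse using (↔-refl; ↔-sym; ↔-trans; ↔⇒↣)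
open import Relation.Nullary using (Dec; yes; no)
open import Relation.Nullary.Decidable using (isYes; map′)
open import Relation.Binary.PropositionalEquality

𝟙 : Bool → ℤ
𝟙 b = if b then + 1 else + 0

i≤i+j : ∀ i {j} → + 0 ≤ j → i ≤ i + j
i≤i+j i j≥0 = subst (_≤ i + _) (ℤₚ.+-identityʳ i) (ℤₚ.+-monoʳ-≤ i j≥0)

nonneg-+-zero : ∀ {a b} → + 0 ≤ a → + 0 ≤ b → a + b ≡ + 0 → a ≡ + 0 × b ≡ + 0
nonneg-+-zero {a} {b} a≥0 b≥0 a+b≡0 =
  ℤₚ.≤-antisym (subst (a ≤_) a+b≡0 (i≤i+j a b≥0)) a≥0 ,
  ℤₚ.≤-antisym (subst (b ≤_) (trans (ℤₚ.+-comm b a) a+b≡0) (i≤i+j b a≥0)) b≥0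

_<?ᵇ_ : ℕ → ℕ → Bool
x <?ᵇ y = isYes (x ℕₚ.<? y)

𝟙-∧-<-irrefl : ∀ b x → 𝟙 (b ∧ x <?ᵇ x) ≡ + 0
𝟙-∧-<-irrefl false x = refl
𝟙-∧-<-irrefl true  x with x ℕₚ.<? x
... | yes x<x = ⊥-elim (ℕₚ.<-irrefl refl x<x)
... | no  _   = refl

𝟙-∧-<-trichotomy : ∀ b x y → x ≢ y → 𝟙 (b ∧ x <?ᵇ y) + 𝟙 (b ∧ y <?ᵇ x) ≡ 𝟙 b
𝟙-∧-<-trichotomy false x y x≢y = refl
𝟙-∧-<-trichotomy true  x y x≢y with x ℕₚ.<? y | y ℕₚ.<? x
... | yes x<y | yes y<x = ⊥-elim (ℕₚ.<-asym x<y y<x)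
... | yes _   | no  _   = refl
... | no  _   | yes _   = refl
... | no  x≮y | no  y≮x = ⊥-elim (x≢y (ℕₚ.≤-antisym (ℕₚ.≮⇒≥ y≮x) (ℕₚ.≮⇒≥ x≮y)))

m+m≢1+n+n : ∀ m n → m ℕ.+ m ≢ suc (n ℕ.+ n)
m+m≢1+n+n (suc m) zero    eq with trans (sym (ℕₚ.+-suc m m)) (ℕₚ.suc-injective eq)
... | ()
m+m≢1+n+n (suc m) (suc n) eq =
  m+m≢1+n+n m n (ℕₚ.suc-injective (trans (sym (ℕₚ.+-suc m m))
                  (trans (ℕₚ.suc-injective eq) (cong suc (ℕₚ.+-suc n n)))))

m+m≡n+n⇒m≡n : ∀ m n → m ℕ.+ m ≡ n ℕ.+ n → m ≡ n
m+m≡n+n⇒m≡n zero    zero    eq = refl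
m+m≡n+n⇒m≡n (suc m) (suc n) eq = cong suc (m+m≡n+n⇒m≡n m n (ℕₚ.suc-injective
  (trans (sym (ℕₚ.+-suc m m)) (trans (ℕₚ.suc-injective eq) (ℕₚ.+-suc n n)))))

P+Q≡2S+d⇒[P≡2-Q+d⇔S≡1] : ∀ P Q S d → P + Q ≡ + 2 * S + d → (P ≡ (+ 2 * + 1 - Q) + d ⇔ S ≡ + 1)
P+Q≡2S+d⇒[P≡2-Q+d⇔S≡1] P Q S d P+Q≡2S+d = mk⇔
  (λ P≡2-Q+d → ℤₚ.*-cancelˡ-≡ (+ 2) S (+ 1) (begin
    + 2 * S                       ≡⟨ cancel-d S d ⟩
    (+ 2 * S + d) - d             ≡⟨ cong (_- d) P+Q≡2S+d ⟨
    (P + Q) - d                   ≡⟨ cong (λ p → (p + Q) - d) P≡2-Q+d ⟩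
    ((+ 2 * + 1 - Q) + d + Q) - d ≡⟨ cancel-Q-d Q d ⟩
    + 2 * + 1                     ∎))
  (λ S≡1 → begin
    P                             ≡⟨ cancel-Q P Q ⟩
    (P + Q) - Q                   ≡⟨ cong (_- Q) P+Q≡2S+d ⟩
    (+ 2 * S + d) - Q             ≡⟨ cong (λ s → (+ 2 * s + d) - Q) S≡1 ⟩
    (+ 2 * + 1 + d) - Q           ≡⟨ reorder Q d ⟩
    (+ 2 * + 1 - Q) + d           ∎)
  where
  open ≡-Reasoning
  cancel-d : ∀ S d → + 2 * S ≡ (+ 2 * S + d) - d
  cancel-d = solve-∀
  cancel-Q-d : ∀ Q d → ((+ 2 * + 1 - Q) + d + Q) - d ≡ + 2 * + 1
  cancel-Q-d = solve-∀
  cancel-Q : ∀ P Q → P ≡ (P + Q) - Q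
  cancel-Q = solve-∀
  reorder : ∀ Q d → (+ 2 * + 1 + d) - Q ≡ (+ 2 * + 1 - Q) + d
  reorder = solve-∀

nonzero? : ℤ → Bool
nonzero? (+ zero) = false
nonzero? _        = true

𝟙-nonzero? : ∀ z → + 0 ≤ z → z ≤ + 1 → 𝟙 (nonzero? z) ≡ z
𝟙-nonzero? (+ 0)           _ _                       = refl
𝟙-nonzero? (+ 1)           _ _                       = refl
𝟙-nonzero? (+ suc (suc k)) _ (ℤ.+≤+ (ℕ.s≤s ()))
𝟙-nonzero? -[1+ k ]        () _

nonzero?-pos : ∀ z → + 1 ≤ z → nonzero? z ≡ true
nonzero?-pos (+ zero)  (ℤ.+≤+ ())
nonzero?-pos (+ suc k) _ = refl
nonzero?-pos -[1+ k ]  ()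

x-[x-y]≡y : ∀ x y → x - (x - y) ≡ y
x-[x-y]≡y = solve-∀

module ℤΣ = CommutativeMonoidSum ℤₚ.+-0-commutativeMonoid

ΣFin≡sum : ∀ m (f : Fin m → ℤ) → ΣFin m f ≡ ℤΣ.sum f
ΣFin≡sum zero    f = refl
ΣFin≡sum (suc m) f = cong (_+_ (f zero)) (ΣFin≡sum m (λ i → f (suc i)))

ΣFin-cong : ∀ m {f g : Fin m → ℤ} → (∀ i → f i ≡ g i) → ΣFin m f ≡ ΣFin m g
ΣFin-cong zero    f≗g = refl
ΣFin-cong (suc m) f≗g = cong₂ _+_ (f≗g zero) (ΣFin-cong m (λ i → f≗g (suc i)))

ΣFin-distrib-+ : ∀ m (f g : Fin m → ℤ) → ΣFin m (λ i → f i + g i) ≡ ΣFin m f + ΣFin m g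
ΣFin-distrib-+ m f g = begin
  ΣFin m (λ i → f i + g i)   ≡⟨ ΣFin≡sum m _ ⟩
  ℤΣ.sum (λ i → f i + g i)   ≡⟨ ℤΣ.∑-distrib-+ f g ⟩
  ℤΣ.sum f + ℤΣ.sum g        ≡⟨ cong₂ _+_ (ΣFin≡sum m f) (ΣFin≡sum m g) ⟨
  ΣFin m f + ΣFin m g        ∎
  where open ≡-Reasoning

ΣFin-comm : ∀ m k (f : Fin m → Fin k → ℤ) →
  ΣFin m (λ i → ΣFin k (f i)) ≡ ΣFin k (λ j → ΣFin m (λ i → f i j))
ΣFin-comm m k f = begin
  ΣFin m (λ i → ΣFin k (f i))              ≡⟨ ΣFin-cong m (λ i → ΣFin≡sum k (f i)) ⟩
  ΣFin m (λ i → ℤΣ.sum (f i))              ≡⟨ ΣFin≡sum m _ ⟩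
  ℤΣ.sum (λ i → ℤΣ.sum (f i))              ≡⟨ ℤΣ.∑-comm f ⟩
  ℤΣ.sum (λ j → ℤΣ.sum (λ i → f i j))      ≡⟨ ΣFin≡sum k _ ⟨
  ΣFin k (λ j → ℤΣ.sum (λ i → f i j))      ≡⟨ ΣFin-cong k (λ j → ΣFin≡sum m _) ⟨
  ΣFin k (λ j → ΣFin m (λ i → f i j))      ∎
  where open ≡-Reasoning

ΣFin-*ʳ : ∀ m (f : Fin m → ℤ) c → ΣFin m (λ i → f i * c) ≡ ΣFin m f * c
ΣFin-*ʳ zero    f c = sym (ℤₚ.*-zeroˡ c)
ΣFin-*ʳ (suc m) f c = trans (cong (_+_ (f zero * c)) (ΣFin-*ʳ m (λ i → f (suc i)) c))
                             (sym (ℤₚ.*-distribʳ-+ c (f zero) _))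

ΣFin-neg : ∀ m (f : Fin m → ℤ) → ΣFin m (λ i → - f i) ≡ - ΣFin m f
ΣFin-neg zero    f = refl
ΣFin-neg (suc m) f = trans (cong (_+_ (- f zero)) (ΣFin-neg m (λ i → f (suc i))))
                            (sym (ℤₚ.neg-distrib-+ (f zero) _))

ΣFin-const-1 : ∀ m → ΣFin m (λ _ → + 1) ≡ + m
ΣFin-const-1 zero    = refl
ΣFin-const-1 (suc m) = cong (_+_ (+ 1)) (ΣFin-const-1 m)

ΣFin-++ : ∀ a b (f : Fin (a ℕ.+ b) → ℤ) →
  ΣFin (a ℕ.+ b) f ≡ ΣFin a (λ i → f (i ↑ˡ b)) + ΣFin b (λ j → f (a ↑ʳ j))
ΣFin-++ zero    b f = sym (ℤₚ.+-identityˡ _)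
ΣFin-++ (suc a) b f = trans (cong (_+_ (f zero)) (ΣFin-++ a b (λ i → f (suc i))))
                             (sym (ℤₚ.+-assoc (f zero) _ _))

ΣFin-zero : ∀ m {f : Fin m → ℤ} → (∀ i → f i ≡ + 0) → ΣFin m f ≡ + 0
ΣFin-zero zero    f≡0 = refl
ΣFin-zero (suc m) f≡0 = trans (cong₂ _+_ (f≡0 zero) (ΣFin-zero m (λ i → f≡0 (suc i)))) (ℤₚ.+-identityˡ _)

ΣFin-select : ∀ m (j : Fin m) (d f : Fin m → ℤ) → d j ≡ + 1 → (∀ i → i ≢ j → d i ≡ + 0) →
  ΣFin m (λ i → d i * f i) ≡ f j
ΣFin-select (suc m) zero d f dj≡1 d≡0 =
  trans (cong₂ _+_ (trans (cong (_* f zero) dj≡1) (ℤₚ.*-identityˡ _)) rest≡0)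
        (ℤₚ.+-identityʳ (f zero))
  where
  rest≡0 : ΣFin m (λ i → d (suc i) * f (suc i)) ≡ + 0
  rest≡0 = ΣFin-zero m (λ i → trans (cong (_* f (suc i)) (d≡0 (suc i) (λ ()))) (ℤₚ.*-zeroˡ (f (suc i))))
ΣFin-select (suc m) (suc j) d f dj≡1 d≡0 =
  trans (cong₂ _+_ (trans (cong (_* f zero) (d≡0 zero (λ ()))) (ℤₚ.*-zeroˡ (f zero)))
                   (ΣFin-select m j (λ i → d (suc i)) (λ i → f (suc i)) dj≡1
                     (λ i i≢j → d≡0 (suc i) (i≢j ∘ Finₚ.suc-injective))))
        (ℤₚ.+-identityˡ (f (suc j)))

ΣFin-nonneg : ∀ m (f : Fin m → ℤ) → (∀ i → + 0 ≤ f i) → + 0 ≤ ΣFin m f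
ΣFin-nonneg zero    f f≥0 = ℤₚ.≤-refl
ΣFin-nonneg (suc m) f f≥0 = ℤₚ.+-mono-≤ (f≥0 zero) (ΣFin-nonneg m _ (λ i → f≥0 (suc i)))

ΣFin-nonneg-zero : ∀ m (f : Fin m → ℤ) → (∀ i → + 0 ≤ f i) → ΣFin m f ≡ + 0 → ∀ i → f i ≡ + 0
ΣFin-nonneg-zero (suc m) f f≥0 Σ≡0 i with nonneg-+-zero (f≥0 zero) (ΣFin-nonneg m _ (f≥0 ∘ suc)) Σ≡0
ΣFin-nonneg-zero (suc m) f f≥0 Σ≡0 zero    | f₀≡0 , _     = f₀≡0
ΣFin-nonneg-zero (suc m) f f≥0 Σ≡0 (suc i) | _    , rest≡0 = ΣFin-nonneg-zero m _ (f≥0 ∘ suc) rest≡0 i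

ΣFin-nonzero : ∀ m (f : Fin m → ℤ) → ΣFin m f ≢ + 0 → Σ (Fin m) (λ i → f i ≢ + 0)
ΣFin-nonzero zero    f Σ≢0 = ⊥-elim (Σ≢0 refl)
ΣFin-nonzero (suc m) f Σ≢0 with f zero ℤₚ.≟ + 0
... | no  f₀≢0 = zero , f₀≢0
... | yes f₀≡0 =
  let i , fᵢ≢0 = ΣFin-nonzero m (λ i → f (suc i)) (λ Σ≡0 → Σ≢0 (cong₂ _+_ f₀≡0 Σ≡0))
  in suc i , fᵢ≢0

ΣFin-filter : ∀ m (q : Fin m → Bool) → Σ ℕ λ L → Σ (Fin L → Fin m) λ s →
  ∀ (H : Fin m → ℤ) → ΣFin L (λ i → H (s i)) ≡ ΣFin m (λ i → 𝟙 (q i) * H i)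
ΣFin-filter zero    q = 0 , (λ ()) , (λ H → refl)
ΣFin-filter (suc m) q with ΣFin-filter m (q ∘ suc) | q zero
... | L , s , filtered | true  = suc L , zero ∷ suc ∘ s , λ H →
  cong₂ _+_ (sym (ℤₚ.*-identityˡ (H zero))) (filtered (H ∘ suc))
... | L , s , filtered | false = L , suc ∘ s , λ H →
  trans (filtered (H ∘ suc)) (sym (ℤₚ.+-identityˡ _))

ΣFin-subst : ∀ {A : Set} {L m} (L≡m : L ≡ m) (g : Fin L → A) (H : A → ℤ) →
  ΣFin m (λ i → H (subst (λ k → Fin k → A) L≡m g i)) ≡ ΣFin L (λ i → H (g i))
ΣFin-subst refl g H = refl

record Enumeration (A : Set) : Set where
  field
    size : ℕ
    enum : A ↔ Fin size

  open Inverse enum public using (to; from; strictlyInverseˡ; strictlyInverseʳ)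

  sum : (A → ℤ) → ℤ
  sum f = ΣFin size (λ i → f (from i))

  to-injective : ∀ {x y} → to x ≡ to y → x ≡ y
  to-injective = Injection.injective (↔⇒↣ enum)

  _≟_ : (x y : A) → Dec (x ≡ y)
  x ≟ y = map′ to-injective (cong to) (to x Finₚ.≟ to y)

  sum-cong : ∀ {f g : A → ℤ} → (∀ x → f x ≡ g x) → sum f ≡ sum g
  sum-cong f≗g = ΣFin-cong size (λ i → f≗g (from i))

  sum-distrib-+ : ∀ (f g : A → ℤ) → sum (λ x → f x + g x) ≡ sum f + sum g
  sum-distrib-+ f g = ΣFin-distrib-+ size _ _

  sum-neg : ∀ (f : A → ℤ) → sum (λ x → - f x) ≡ - sum f
  sum-neg f = ΣFin-neg size _

  sum-comm-ΣFin : ∀ k (f : A → Fin k → ℤ) → sum (λ x → ΣFin k (f x)) ≡ ΣFin k (λ j → sum (λ x → f x j))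
  sum-comm-ΣFin k f = ΣFin-comm size k _

  sum-select : ∀ c (d f : A → ℤ) → d c ≡ + 1 → (∀ x → x ≢ c → d x ≡ + 0) → sum (λ x → d x * f x) ≡ f c
  sum-select c d f dc≡1 d≡0 =
    trans (ΣFin-select size (to c) _ _ (trans (cong d (strictlyInverseʳ c)) dc≡1)
                        (λ i i≢c → d≡0 (from i) (λ from-i≡c → i≢c (trans (sym (strictlyInverseˡ i)) (cong to from-i≡c)))))
          (cong f (strictlyInverseʳ c))

  sum-nonzero : ∀ (f : A → ℤ) → sum f ≢ + 0 → Σ A (λ x → f x ≢ + 0)
  sum-nonzero f sum≢0 = let i , fᵢ≢0 = ΣFin-nonzero size _ sum≢0 in from i , fᵢ≢0

  sum-reindex : (ψ ψ′ : A → A) → (∀ x → ψ′ (ψ x) ≡ x) → (∀ x → ψ (ψ′ x) ≡ x) →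
                ∀ f → sum (λ x → f (ψ x)) ≡ sum f
  sum-reindex ψ ψ′ ψ′ψ ψψ′ f = begin
    sum (λ x → f (ψ x))                   ≡⟨ ΣFin≡sum size _ ⟩
    ℤΣ.sum (λ i → f (ψ (from i)))         ≡⟨ ℤΣ.sum-cong-≗ {size} (λ i → cong f (strictlyInverseʳ (ψ (from i)))) ⟨
    ℤΣ.sum (λ i → f (from (π ⟨$⟩ʳ i)))    ≡⟨ ℤΣ.sum-permute (λ i → f (from i)) π ⟨
    ℤΣ.sum (λ i → f (from i))             ≡⟨ ΣFin≡sum size _ ⟨
    sum f                                 ∎
    where
    open ≡-Reasoning
    π : Permutation size size
    π = mk↔ₛ′ (λ i → to (ψ (from i))) (λ i → to (ψ′ (from i)))
              (λ i → trans (cong (to ∘ ψ) (strictlyInverseʳ _)) (trans (cong to (ψψ′ _)) (strictlyInverseˡ i)))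
              (λ i → trans (cong (to ∘ ψ′) (strictlyInverseʳ _)) (trans (cong to (ψ′ψ _)) (strictlyInverseˡ i)))

  sum-nonneg-zero : ∀ (f : A → ℤ) → (∀ x → + 0 ≤ f x) → sum f ≡ + 0 → ∀ x → f x ≡ + 0
  sum-nonneg-zero f f≥0 sum≡0 x =
    trans (cong f (sym (strictlyInverseʳ x))) (ΣFin-nonneg-zero size _ (λ i → f≥0 (from i)) sum≡0 (to x))

  private
    𝟙[_≡_] : A → A → ℤ
    𝟙[ x ≡ a ] = 𝟙 (isYes (x ≟ a))

    𝟙[≡]-refl : ∀ a → 𝟙[ a ≡ a ] ≡ + 1
    𝟙[≡]-refl a with a ≟ a
    ... | yes _   = refl
    ... | no  a≢a = ⊥-elim (a≢a refl)

    𝟙[≢] : ∀ {x a} → x ≢ a → 𝟙[ x ≡ a ] ≡ + 0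
    𝟙[≢] {x} {a} x≢a with x ≟ a
    ... | yes x≡a = ⊥-elim (x≢a x≡a)
    ... | no  _   = refl

  sum-unique : ∀ (f : A → ℤ) → (∀ x → + 0 ≤ f x) → sum f ≡ + 1 → ∀ {a b} → f a ≡ + 1 → f b ≡ + 1 → a ≡ b
  sum-unique f f≥0 sum≡1 {a} {b} fa≡1 fb≡1 with b ≟ a
  ... | yes b≡a = sym b≡a
  ... | no  b≢a = ⊥-elim (f′b≢0 (sum-nonneg-zero f′ f′≥0 sum-f′≡0 b))
    where
    f′ : A → ℤ
    f′ x = f x - 𝟙[ x ≡ a ]
    f′≥0 : ∀ x → + 0 ≤ f′ x
    f′≥0 x with x ≟ a
    ... | yes refl = ℤₚ.≤-reflexive (sym (cong (_- + 1) fa≡1))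
    ... | no  _    = subst (+ 0 ≤_) (sym (ℤₚ.+-identityʳ (f x))) (f≥0 x)
    sum-f′≡0 : sum f′ ≡ + 0
    sum-f′≡0 = begin
      sum f′                                   ≡⟨ sum-distrib-+ f (λ x → - 𝟙[ x ≡ a ]) ⟩
      sum f + sum (λ x → - 𝟙[ x ≡ a ])         ≡⟨ cong (_+_ (sum f)) (sum-neg (λ x → 𝟙[ x ≡ a ])) ⟩
      sum f - sum (λ x → 𝟙[ x ≡ a ])           ≡⟨ cong₂ _-_ sum≡1 (sum-cong (λ x → sym (ℤₚ.*-identityʳ 𝟙[ x ≡ a ]))) ⟩
      + 1 - sum (λ x → 𝟙[ x ≡ a ] * + 1)       ≡⟨ cong (_-_ (+ 1)) (sum-select a (λ x → 𝟙[ x ≡ a ]) (λ _ → + 1) (𝟙[≡]-refl a) (λ x → 𝟙[≢])) ⟩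
      + 0                                      ∎
      where open ≡-Reasoning
    f′b≢0 : f′ b ≢ + 0
    f′b≢0 f′b≡0 with trans (sym (cong₂ _-_ fb≡1 (𝟙[≢] b≢a))) f′b≡0
    ... | ()

⊤-enumeration : Enumeration ⊤
⊤-enumeration = record { size = 1 ; enum = ↔-sym Finₚ.1↔⊤ }

Fin-enumeration : ∀ n → Enumeration (Fin n)
Fin-enumeration n = record { size = n ; enum = ↔-refl }

_⊎-enumeration_ : ∀ {A B} → Enumeration A → Enumeration B → Enumeration (A ⊎ B)
EA ⊎-enumeration EB = record
  { size = Enumeration.size EA ℕ.+ Enumeration.size EB
  ; enum = ↔-trans (Enumeration.enum EA ⊎-↔ Enumeration.enum EB) (↔-sym Finₚ.+↔⊎) }

sum-⊤ : ∀ f → Enumeration.sum ⊤-enumeration f ≡ f tt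
sum-⊤ f = ℤₚ.+-identityʳ (f tt)

sum-⊎ : ∀ {A B} (EA : Enumeration A) (EB : Enumeration B) f →
  Enumeration.sum (EA ⊎-enumeration EB) f ≡
  Enumeration.sum EA (λ x → f (inj₁ x)) + Enumeration.sum EB (λ y → f (inj₂ y))
sum-⊎ EA EB f = trans (ΣFin-++ a b _)
  (cong₂ _+_ (ΣFin-cong a (λ i → cong (f ∘ Data.Sum.map A.from B.from) (Finₚ.splitAt-↑ˡ a i b)))
             (ΣFin-cong b (λ j → cong (f ∘ Data.Sum.map A.from B.from) (Finₚ.splitAt-↑ʳ a b j))))
  where
  module A = Enumeration EA
  module B = Enumeration EB
  a b : ℕ
  a = A.size
  b = B.size

-- The Lee sphere S(n,2) as a finite type

0ᵥ : ∀ {n} → ℤ^ n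
0ᵥ _ = + 0

_+ᵥ_ : ∀ {n} → ℤ^ n → ℤ^ n → ℤ^ n
(x +ᵥ y) i = x i + y i

-ᵥ_ : ∀ {n} → ℤ^ n → ℤ^ n
(-ᵥ x) i = - x i

infix 7 _·e_
_·e_ : ∀ {n} → ℤ → Fin n → ℤ^ n
(z ·e zero)  zero    = z
(z ·e zero)  (suc i) = + 0
(z ·e suc j) zero    = + 0
(z ·e suc j) (suc i) = (z ·e j) i

e : ∀ {n} → Fin n → ℤ^ n
e j = + 1 ·e j

-1ℤ : ℤ
-1ℤ = -[1+ 0 ]

-- S₁ n lists S(n,1) as 0, e j, -e j.  S₂ (suc n) sorts S(n+1,2) by the first
-- coordinate (0, positive, negative), and S₂⁺ n lists the tails after a first
-- coordinate of absolute value 2 (only 0) or 1 (a point of S(n,1)).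
S₁ : ℕ → Set
S₁ n = ⊤ ⊎ (Fin n ⊎ Fin n)

S₂⁺ : ℕ → Set
S₂⁺ n = ⊤ ⊎ S₁ n

S₂ : ℕ → Set
S₂ zero    = ⊤
S₂ (suc n) = S₂ n ⊎ (S₂⁺ n ⊎ S₂⁺ n)

vec₁ : ∀ {n} → S₁ n → ℤ^ n
vec₁ (inj₁ tt)       = 0ᵥ
vec₁ (inj₂ (inj₁ j)) = + 1 ·e j
vec₁ (inj₂ (inj₂ j)) = -1ℤ ·e j

vec₂⁺ : ∀ {n} → ℤ → S₂⁺ n → ℤ^ (suc n)
vec₂⁺ u (inj₁ tt) = (u + u) ∷ 0ᵥ
vec₂⁺ u (inj₂ t)  = u ∷ vec₁ t

vec₂ : ∀ {n} → S₂ n → ℤ^ n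
vec₂ {zero}  _               ()
vec₂ {suc n} (inj₁ a)        = + 0 ∷ vec₂ a
vec₂ {suc n} (inj₂ (inj₁ c)) = vec₂⁺ (+ 1) c
vec₂ {suc n} (inj₂ (inj₂ c)) = vec₂⁺ -1ℤ c

S₁-enumeration : ∀ n → Enumeration (S₁ n)
S₁-enumeration n = ⊤-enumeration ⊎-enumeration (Fin-enumeration n ⊎-enumeration Fin-enumeration n)

S₂⁺-enumeration : ∀ n → Enumeration (S₂⁺ n)
S₂⁺-enumeration n = ⊤-enumeration ⊎-enumeration S₁-enumeration n

S₂-enumeration : ∀ n → Enumeration (S₂ n)
S₂-enumeration zero    = ⊤-enumeration
S₂-enumeration (suc n) = S₂-enumeration n ⊎-enumeration (S₂⁺-enumeration n ⊎-enumeration S₂⁺-enumeration n)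

∣S₂∣ : ∀ n → Enumeration.size (S₂-enumeration n) ≡ 2 ℕ.* n ℕ.* n ℕ.+ 2 ℕ.* n ℕ.+ 1
∣S₂∣ zero    = refl
∣S₂∣ (suc n) = trans (cong (ℕ._+ (2 ℕ.+ (n ℕ.+ n) ℕ.+ (2 ℕ.+ (n ℕ.+ n)))) (∣S₂∣ n)) (lemma n)
  where
  lemma : ∀ n → 2 ℕ.* n ℕ.* n ℕ.+ 2 ℕ.* n ℕ.+ 1 ℕ.+ (2 ℕ.+ (n ℕ.+ n) ℕ.+ (2 ℕ.+ (n ℕ.+ n)))
              ≡ 2 ℕ.* suc n ℕ.* suc n ℕ.+ 2 ℕ.* suc n ℕ.+ 1
  lemma = ℕSolver.solve-∀

shift₁ : ∀ {n} → S₁ n → S₁ (suc n)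
shift₁ (inj₁ tt)       = inj₁ tt
shift₁ (inj₂ (inj₁ j)) = inj₂ (inj₁ (suc j))
shift₁ (inj₂ (inj₂ j)) = inj₂ (inj₂ (suc j))

cons₁ : ∀ {n} → ℤ → S₁ n → S₁ (suc n)
cons₁ (+ 1)    t = inj₂ (inj₁ zero)
cons₁ -[1+ 0 ] t = inj₂ (inj₂ zero)
cons₁ _        t = shift₁ t

code₁ : ∀ {n} → ℤ^ n → S₁ n
code₁ {zero}  x = inj₁ tt
code₁ {suc n} x = cons₁ (x zero) (code₁ (tail x))

cons₂ : ∀ {n} → ℤ → S₂ n → S₁ n → S₂ (suc n)
cons₂ (+ 0)    a t = inj₁ a
cons₂ (+ 1)    a t = inj₂ (inj₁ (inj₂ t))
cons₂ (+ 2)    a t = inj₂ (inj₁ (inj₁ tt))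
cons₂ -[1+ 0 ] a t = inj₂ (inj₂ (inj₂ t))
cons₂ -[1+ 1 ] a t = inj₂ (inj₂ (inj₁ tt))
cons₂ _        a t = inj₁ a

-- Outside S(n,2) the value of code₂ is meaningless.
code₂ : ∀ {n} → ℤ^ n → S₂ n
code₂ {zero}  x = tt
code₂ {suc n} x = cons₂ (x zero) (code₂ (tail x)) (code₁ (tail x))

code₁-0ᵥ : ∀ n → code₁ {n} 0ᵥ ≡ inj₁ tt
code₁-0ᵥ zero    = refl
code₁-0ᵥ (suc n) = cong shift₁ (code₁-0ᵥ n)

code₁-e : ∀ {n} (j : Fin n) → code₁ (+ 1 ·e j) ≡ inj₂ (inj₁ j)
code₁-e zero    = refl
code₁-e (suc j) = cong shift₁ (code₁-e j)

code₁-−e : ∀ {n} (j : Fin n) → code₁ (-1ℤ ·e j) ≡ inj₂ (inj₂ j)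
code₁-−e zero    = refl
code₁-−e (suc j) = cong shift₁ (code₁-−e j)

code₁-vec₁ : ∀ {n} (t : S₁ n) → code₁ (vec₁ t) ≡ t
code₁-vec₁ {n} (inj₁ tt)   = code₁-0ᵥ n
code₁-vec₁ (inj₂ (inj₁ j)) = code₁-e j
code₁-vec₁ (inj₂ (inj₂ j)) = code₁-−e j

code₂-vec₂ : ∀ {n} (a : S₂ n) → code₂ (vec₂ a) ≡ a
code₂-vec₂ {zero}  tt                      = refl
code₂-vec₂ {suc n} (inj₁ a)                = cong inj₁ (code₂-vec₂ a)
code₂-vec₂ {suc n} (inj₂ (inj₁ (inj₁ tt))) = refl
code₂-vec₂ {suc n} (inj₂ (inj₁ (inj₂ t)))  = cong (inj₂ ∘ inj₁ ∘ inj₂) (code₁-vec₁ t)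
code₂-vec₂ {suc n} (inj₂ (inj₂ (inj₁ tt))) = refl
code₂-vec₂ {suc n} (inj₂ (inj₂ (inj₂ t)))  = cong (inj₂ ∘ inj₂ ∘ inj₂) (code₁-vec₁ t)

code₁-cong : ∀ {n} {x y : ℤ^ n} → x ≗ᵥ y → code₁ x ≡ code₁ y
code₁-cong {zero}  x≗y = refl
code₁-cong {suc n} x≗y = cong₂ cons₁ (x≗y zero) (code₁-cong (x≗y ∘ suc))

code₂-cong : ∀ {n} {x y : ℤ^ n} → x ≗ᵥ y → code₂ x ≡ code₂ y
code₂-cong {zero}  x≗y = refl
code₂-cong {suc n} {x} {y} x≗y =
  trans (cong (λ z → cons₂ z (code₂ (tail x)) (code₁ (tail x))) (x≗y zero))
        (cong₂ (cons₂ (y zero)) (code₂-cong (x≗y ∘ suc)) (code₁-cong (x≗y ∘ suc)))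

leeNorm-0ᵥ : ∀ n → leeNorm {n} 0ᵥ ≡ 0
leeNorm-0ᵥ zero    = refl
leeNorm-0ᵥ (suc n) = leeNorm-0ᵥ n

leeNorm-·e : ∀ {n} z (j : Fin n) → leeNorm (z ·e j) ≡ ℤ.∣ z ∣
leeNorm-·e {suc n} z zero    = trans (cong (ℤ.∣ z ∣ ℕ.+_) (leeNorm-0ᵥ n)) (ℕₚ.+-identityʳ _)
leeNorm-·e {suc n} z (suc j) = leeNorm-·e z j

leeNorm-cong : ∀ {n} {x y : ℤ^ n} → x ≗ᵥ y → leeNorm x ≡ leeNorm y
leeNorm-cong {zero}  x≗y = refl
leeNorm-cong {suc n} x≗y = cong₂ ℕ._+_ (cong ℤ.∣_∣ (x≗y zero)) (leeNorm-cong (x≗y ∘ suc))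

leeNorm≤0⇒0ᵥ : ∀ {n} (x : ℤ^ n) → leeNorm x ℕ.≤ 0 → x ≗ᵥ 0ᵥ
leeNorm≤0⇒0ᵥ {suc n} x ∣x∣≤0 zero    = ℤₚ.∣i∣≡0⇒i≡0 (ℕₚ.m+n≡0⇒m≡0 _ (ℕₚ.n≤0⇒n≡0 ∣x∣≤0))
leeNorm≤0⇒0ᵥ {suc n} x ∣x∣≤0 (suc i) =
  leeNorm≤0⇒0ᵥ (tail x) (ℕₚ.≤-reflexive (ℕₚ.m+n≡0⇒n≡0 ℤ.∣ x zero ∣ (ℕₚ.n≤0⇒n≡0 ∣x∣≤0))) i

leeNorm-vec₁ : ∀ {n} (t : S₁ n) → leeNorm (vec₁ t) ℕ.≤ 1
leeNorm-vec₁ {n} (inj₁ tt)   = ℕₚ.≤-trans (ℕₚ.≤-reflexive (leeNorm-0ᵥ n)) ℕ.z≤n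
leeNorm-vec₁ (inj₂ (inj₁ j)) = ℕₚ.≤-reflexive (leeNorm-·e (+ 1) j)
leeNorm-vec₁ (inj₂ (inj₂ j)) = ℕₚ.≤-reflexive (leeNorm-·e -1ℤ j)

leeNorm-vec₂ : ∀ {n} (a : S₂ n) → vec₂ a ∈S[ 2 ]
leeNorm-vec₂ {zero}  a                       = ℕ.z≤n
leeNorm-vec₂ {suc n} (inj₁ a)                = leeNorm-vec₂ a
leeNorm-vec₂ {suc n} (inj₂ (inj₁ (inj₁ tt))) = ℕₚ.≤-reflexive (cong (2 ℕ.+_) (leeNorm-0ᵥ n))
leeNorm-vec₂ {suc n} (inj₂ (inj₁ (inj₂ t)))  = ℕ.s≤s (leeNorm-vec₁ t)
leeNorm-vec₂ {suc n} (inj₂ (inj₂ (inj₁ tt))) = ℕₚ.≤-reflexive (cong (2 ℕ.+_) (leeNorm-0ᵥ n))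
leeNorm-vec₂ {suc n} (inj₂ (inj₂ (inj₂ t)))  = ℕ.s≤s (leeNorm-vec₁ t)

shift₁-vec₁ : ∀ {n} (t : S₁ n) → vec₁ (shift₁ t) ≗ᵥ (+ 0 ∷ vec₁ t)
shift₁-vec₁ (inj₁ tt)       zero    = refl
shift₁-vec₁ (inj₁ tt)       (suc i) = refl
shift₁-vec₁ (inj₂ (inj₁ j)) zero    = refl
shift₁-vec₁ (inj₂ (inj₁ j)) (suc i) = refl
shift₁-vec₁ (inj₂ (inj₂ j)) zero    = refl
shift₁-vec₁ (inj₂ (inj₂ j)) (suc i) = refl

head∷tail : ∀ {n} (x : ℤ^ (suc n)) → (x zero ∷ tail x) ≗ᵥ x
head∷tail x zero    = refl
head∷tail x (suc i) = refl

vec₁-code₁ : ∀ {n} (x : ℤ^ n) → x ∈S[ 1 ] → vec₁ (code₁ x) ≗ᵥ x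
vec₁-cons₁ : ∀ {n} z (x : ℤ^ n) → ℤ.∣ z ∣ ℕ.+ leeNorm x ℕ.≤ 1 → vec₁ (cons₁ z (code₁ x)) ≗ᵥ (z ∷ x)
vec₁-code₁ {suc n} x x∈S i = trans (vec₁-cons₁ (x zero) (tail x) x∈S i) (head∷tail x i)
vec₁-cons₁ (+ 0)            x x∈S  zero    = shift₁-vec₁ (code₁ x) zero
vec₁-cons₁ (+ 0)            x x∈S  (suc i) = trans (shift₁-vec₁ (code₁ x) (suc i)) (vec₁-code₁ x x∈S i)
vec₁-cons₁ (+ 1)            x x∈S  zero    = refl
vec₁-cons₁ (+ 1)            x (ℕ.s≤s x∈S) (suc i) = sym (leeNorm≤0⇒0ᵥ x x∈S i)
vec₁-cons₁ -[1+ 0 ]         x x∈S  zero    = refl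
vec₁-cons₁ -[1+ 0 ]         x (ℕ.s≤s x∈S) (suc i) = sym (leeNorm≤0⇒0ᵥ x x∈S i)
vec₁-cons₁ (+ suc (suc k))  x (ℕ.s≤s ())
vec₁-cons₁ -[1+ suc k ]     x (ℕ.s≤s ())

vec₂-code₂ : ∀ {n} (x : ℤ^ n) → x ∈S[ 2 ] → vec₂ (code₂ x) ≗ᵥ x
vec₂-cons₂ : ∀ {n} z (x : ℤ^ n) → ℤ.∣ z ∣ ℕ.+ leeNorm x ℕ.≤ 2 →
  vec₂ (cons₂ z (code₂ x) (code₁ x)) ≗ᵥ (z ∷ x)
vec₂-code₂ {suc n} x x∈S i = trans (vec₂-cons₂ (x zero) (tail x) x∈S i) (head∷tail x i)
vec₂-cons₂ (+ 0)                x x∈S zero    = refl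
vec₂-cons₂ (+ 0)                x x∈S (suc i) = vec₂-code₂ x x∈S i
vec₂-cons₂ (+ 1)                x x∈S zero    = refl
vec₂-cons₂ (+ 1)                x (ℕ.s≤s x∈S) (suc i) = vec₁-code₁ x x∈S i
vec₂-cons₂ (+ 2)                x x∈S zero    = refl
vec₂-cons₂ (+ 2)                x (ℕ.s≤s (ℕ.s≤s x∈S)) (suc i) = sym (leeNorm≤0⇒0ᵥ x x∈S i)
vec₂-cons₂ -[1+ 0 ]             x x∈S zero    = refl
vec₂-cons₂ -[1+ 0 ]             x (ℕ.s≤s x∈S) (suc i) = vec₁-code₁ x x∈S i
vec₂-cons₂ -[1+ 1 ]             x x∈S zero    = refl
vec₂-cons₂ -[1+ 1 ]             x (ℕ.s≤s (ℕ.s≤s x∈S)) (suc i) = sym (leeNorm≤0⇒0ᵥ x x∈S i)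
vec₂-cons₂ (+ suc (suc (suc k))) x (ℕ.s≤s (ℕ.s≤s ()))
vec₂-cons₂ -[1+ suc (suc k) ]   x (ℕ.s≤s (ℕ.s≤s ()))

−e≗-ᵥe : ∀ {n} (j : Fin n) → (-1ℤ ·e j) ≗ᵥ (-ᵥ e j)
−e≗-ᵥe zero    zero    = refl
−e≗-ᵥe zero    (suc i) = refl
−e≗-ᵥe (suc j) zero    = refl
−e≗-ᵥe (suc j) (suc i) = −e≗-ᵥe j i

∷≗·e+0∷ : ∀ {n} u (x : ℤ^ n) → (u ∷ x) ≗ᵥ ((u ·e zero) +ᵥ (+ 0 ∷ x))
∷≗·e+0∷ u x zero    = sym (ℤₚ.+-identityʳ u)
∷≗·e+0∷ u x (suc i) = sym (ℤₚ.+-identityˡ (x i))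

module GroupProperties (G : FinAbGroup) where
  open FinAbGroup G public
  open IsAbelianGroup isAbelianGroup public using (assoc; identityˡ; identityʳ; inverseˡ; inverseʳ; comm)

  abelianGroup : AbelianGroup _ _
  abelianGroup = record { isAbelianGroup = isAbelianGroup }

  open AbelianGroupProperties abelianGroup public
    using (⁻¹-involutive; ε⁻¹≈ε; ⁻¹-∙-comm; y≈x\\z; \\-leftDividesˡ; ∙-cancelˡ)
  open import Algebra.Properties.CommutativeSemigroup (AbelianGroup.commutativeSemigroup abelianGroup) public
    using (interchange)

  elements : Enumeration Carrier
  elements = record { size = order ; enum = enum }

  open Enumeration elements public
    using (to-injective; sum-cong; sum-distrib-+; sum-comm-ΣFin; sum-select; sum-reindex)

  index : Carrier → ℕ
  index h = toℕ (to h)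

  index-injective : ∀ {x y} → index x ≡ index y → x ≡ y
  index-injective = to-injective ∘ Finₚ.toℕ-injective

  δ-≡ : ∀ {x y} → x ≡ y → δ x y ≡ + 1
  δ-≡ {x} {y} x≡y with x ≟ y
  ... | yes _   = refl
  ... | no  x≢y = ⊥-elim (x≢y x≡y)

  δ-≢ : ∀ {x y} → x ≢ y → δ x y ≡ + 0
  δ-≢ {x} {y} x≢y with x ≟ y
  ... | yes x≡y = ⊥-elim (x≢y x≡y)
  ... | no  _   = refl

  δ-cong-⇔ : ∀ {x y x′ y′} → (x ≡ y → x′ ≡ y′) → (x′ ≡ y′ → x ≡ y) → δ x y ≡ δ x′ y′
  δ-cong-⇔ {x} {y} to from with x ≟ y
  ... | yes x≡y = sym (δ-≡ (to x≡y))
  ... | no  x≢y = sym (δ-≢ (x≢y ∘ from))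

  δ-sym : ∀ x y → δ x y ≡ δ y x
  δ-sym x y = δ-cong-⇔ sym sym

  δ-nonneg : ∀ x y → + 0 ≤ δ x y
  δ-nonneg x y with x ≟ y
  ... | yes _ = ℤ.+≤+ ℕ.z≤n
  ... | no  _ = ℤ.+≤+ ℕ.z≤n

  δ≢0⇒≡ : ∀ {x y} → δ x y ≢ + 0 → x ≡ y
  δ≢0⇒≡ {x} {y} δ≢0 with x ≟ y
  ... | yes x≡y = x≡y
  ... | no  _   = ⊥-elim (δ≢0 refl)

  ΣG-δˡ : ∀ a (f : Carrier → ℤ) → ΣG (λ h → δ h a * f h) ≡ f a
  ΣG-δˡ a f = sum-select a (λ h → δ h a) f (δ-≡ refl) (λ h → δ-≢)

  ΣG-δʳ : ∀ a (f : Carrier → ℤ) → ΣG (λ h → f h * δ h a) ≡ f a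
  ΣG-δʳ a f = trans (sum-cong (λ h → ℤₚ.*-comm (f h) (δ h a))) (ΣG-δˡ a f)

  ΣG-δ : ∀ a → ΣG (λ h → δ h a) ≡ + 1
  ΣG-δ a = trans (sum-cong (λ h → sym (ℤₚ.*-identityʳ (δ h a)))) (ΣG-δˡ a (λ _ → + 1))

  ∙-solveʳ : ∀ {x y z} → y ≡ (x ⁻¹) ∙ z → x ∙ y ≡ z
  ∙-solveʳ {x} {y} {z} y≡x⁻¹z = trans (cong (x ∙_) y≡x⁻¹z) (\\-leftDividesˡ x z)

  -- Pairing h with a ∙ h and counting the pairs whose first member has the smaller index
  -- shows that a fixed-point-free involution forces even order.
  odd-order⇒involution-free : ∀ k → order ≡ suc (k ℕ.+ k) → ∀ a → a ∙ a ≡ ε → a ≡ ε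
  odd-order⇒involution-free k ∣G∣≡odd a a∙a≡ε with a ≟ ε
  ... | yes a≡ε = a≡ε
  ... | no  a≢ε = ⊥-elim (parity (ΣG Q) (trans (sym order≡2ΣQ) (cong +_ ∣G∣≡odd)))
    where
    Q : Carrier → ℤ
    Q h = 𝟙 (index h <?ᵇ index (a ∙ h))
    a∙a∙h : ∀ h → a ∙ (a ∙ h) ≡ h
    a∙a∙h h = trans (sym (assoc a a h)) (trans (cong (_∙ h) a∙a≡ε) (identityˡ h))
    a∙h≢h : ∀ h → index h ≢ index (a ∙ h)
    a∙h≢h h eq = a≢ε (sym (∙-cancelˡ h ε a (trans (identityʳ h) (trans (index-injective eq) (comm a h)))))
    Q-pair : ∀ h → Q h + Q (a ∙ h) ≡ + 1
    Q-pair h = trans (cong (λ x → Q h + 𝟙 (index (a ∙ h) <?ᵇ index x)) (a∙a∙h h))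
                     (𝟙-∧-<-trichotomy true _ _ (a∙h≢h h))
    order≡2ΣQ : + order ≡ ΣG Q + ΣG Q
    order≡2ΣQ = begin
      + order                          ≡⟨ ΣFin-const-1 order ⟨
      ΣG (λ _ → + 1)                   ≡⟨ sum-cong (λ h → sym (Q-pair h)) ⟩
      ΣG (λ h → Q h + Q (a ∙ h))       ≡⟨ sum-distrib-+ Q (λ h → Q (a ∙ h)) ⟩
      ΣG Q + ΣG (λ h → Q (a ∙ h))      ≡⟨ cong (_+_ (ΣG Q)) (sum-reindex (a ∙_) (a ∙_) a∙a∙h a∙a∙h Q) ⟩
      ΣG Q + ΣG Q                      ∎
      where open ≡-Reasoning
    parity : ∀ s → s + s ≢ + suc (k ℕ.+ k)
    parity (+ m)    eq = m+m≢1+n+n m k (ℤₚ.+-injective eq)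
    parity -[1+ m ] ()

module Homomorphisms (G : FinAbGroup) where
  open GroupProperties G public

  record IsHomomorphism {n} (r : ℤ^ n → Carrier) : Set where
    field
      cong-≗ : ∀ {x y} → x ≗ᵥ y → r x ≡ r y
      homo-+ : ∀ x y → r (x +ᵥ y) ≡ r x ∙ r y
      homo-- : ∀ x → r (-ᵥ x) ≡ r x ⁻¹

    homo-0 : r 0ᵥ ≡ ε
    homo-0 = ∙-cancelˡ (r 0ᵥ) (r 0ᵥ) ε
      (trans (sym (homo-+ 0ᵥ 0ᵥ)) (trans (cong-≗ (λ i → refl)) (sym (identityʳ (r 0ᵥ)))))

    homo-−e : ∀ j → r (-1ℤ ·e j) ≡ r (e j) ⁻¹
    homo-−e j = trans (cong-≗ (−e≗-ᵥe j)) (homo-- (e j))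

  tail-homomorphism : ∀ {n} {r : ℤ^ (suc n) → Carrier} → IsHomomorphism r → IsHomomorphism (λ x → r (+ 0 ∷ x))
  tail-homomorphism {r = r} hom = record
    { cong-≗ = λ x≗y → cong-≗ (λ { zero → refl ; (suc i) → x≗y i })
    ; homo-+ = λ x y → trans (cong-≗ (λ { zero → refl ; (suc i) → refl })) (homo-+ (+ 0 ∷ x) (+ 0 ∷ y))
    ; homo-- = λ x → trans (cong-≗ (λ { zero → refl ; (suc i) → refl })) (homo-- (+ 0 ∷ x))
    }
    where open IsHomomorphism hom

  ^ℕ-+ : ∀ x a b → x ^ℕ (a ℕ.+ b) ≡ (x ^ℕ a) ∙ (x ^ℕ b)
  ^ℕ-+ x zero    b = sym (identityˡ _)
  ^ℕ-+ x (suc a) b = trans (cong (x ∙_) (^ℕ-+ x a b)) (sym (assoc _ _ _))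

  ^-⊖ : ∀ x a b → x ^ (a ℤ.⊖ b) ≡ (x ^ℕ a) ∙ ((x ^ℕ b) ⁻¹)
  ^-⊖ x a       zero    = sym (trans (cong ((x ^ℕ a) ∙_) ε⁻¹≈ε) (identityʳ _))
  ^-⊖ x zero    (suc b) = sym (identityˡ _)
  ^-⊖ x (suc a) (suc b) = begin
    x ^ (suc a ℤ.⊖ suc b)                        ≡⟨ cong (x ^_) (ℤₚ.[1+m]⊖[1+n]≡m⊖n a b) ⟩
    x ^ (a ℤ.⊖ b)                                ≡⟨ ^-⊖ x a b ⟩
    (x ^ℕ a) ∙ ((x ^ℕ b) ⁻¹)                     ≡⟨ identityˡ _ ⟨
    ε ∙ ((x ^ℕ a) ∙ ((x ^ℕ b) ⁻¹))               ≡⟨ cong (_∙ ((x ^ℕ a) ∙ ((x ^ℕ b) ⁻¹))) (inverseʳ x) ⟨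
    (x ∙ (x ⁻¹)) ∙ ((x ^ℕ a) ∙ ((x ^ℕ b) ⁻¹))    ≡⟨ interchange _ _ _ _ ⟩
    (x ∙ (x ^ℕ a)) ∙ ((x ⁻¹) ∙ ((x ^ℕ b) ⁻¹))    ≡⟨ cong ((x ∙ (x ^ℕ a)) ∙_) (⁻¹-∙-comm x (x ^ℕ b)) ⟩
    (x ∙ (x ^ℕ a)) ∙ ((x ∙ (x ^ℕ b)) ⁻¹)         ∎
    where open ≡-Reasoning

  ^-+ : ∀ x a b → x ^ (a + b) ≡ (x ^ a) ∙ (x ^ b)
  ^-+ x (+ a)    (+ b)    = ^ℕ-+ x a b
  ^-+ x (+ a)    -[1+ b ] = ^-⊖ x a (suc b)
  ^-+ x -[1+ a ] (+ b)    = trans (^-⊖ x b (suc a)) (comm _ _)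
  ^-+ x -[1+ a ] -[1+ b ] = begin
    (x ^ℕ suc (suc (a ℕ.+ b))) ⁻¹                ≡⟨ cong (λ k → (x ^ℕ suc k) ⁻¹) (ℕₚ.+-suc a b) ⟨
    (x ^ℕ (suc a ℕ.+ suc b)) ⁻¹                  ≡⟨ cong _⁻¹ (^ℕ-+ x (suc a) (suc b)) ⟩
    ((x ^ℕ suc a) ∙ (x ^ℕ suc b)) ⁻¹             ≡⟨ ⁻¹-∙-comm _ _ ⟨
    ((x ^ℕ suc a) ⁻¹) ∙ ((x ^ℕ suc b) ⁻¹)        ∎
    where open ≡-Reasoning

  ^-neg : ∀ x z → x ^ (- z) ≡ (x ^ z) ⁻¹
  ^-neg x (+ zero)  = sym ε⁻¹≈ε
  ^-neg x (+ suc k) = refl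
  ^-neg x -[1+ k ]  = sym (⁻¹-involutive _)

  φ : ∀ {n} → (Fin n → Carrier) → ℤ^ n → Carrier
  φ {zero}  g x = ε
  φ {suc n} g x = (g zero ^ x zero) ∙ φ (g ∘ suc) (tail x)

  φ-homomorphism : ∀ {n} (g : Fin n → Carrier) → IsHomomorphism (φ g)
  φ-homomorphism {zero} g = record
    { cong-≗ = λ _ → refl
    ; homo-+ = λ _ _ → sym (identityˡ ε)
    ; homo-- = λ _ → sym ε⁻¹≈ε }
  φ-homomorphism {suc n} g = record
    { cong-≗ = λ x≗y → cong₂ _∙_ (cong (g zero ^_) (x≗y zero)) (cong-≗ (x≗y ∘ suc))
    ; homo-+ = λ x y → trans (cong₂ _∙_ (^-+ (g zero) (x zero) (y zero)) (homo-+ (tail x) (tail y)))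
                             (interchange _ _ _ _)
    ; homo-- = λ x → trans (cong₂ _∙_ (^-neg (g zero) (x zero)) (homo-- (tail x))) (⁻¹-∙-comm _ _) }
    where open IsHomomorphism (φ-homomorphism (g ∘ suc))

  φ-e : ∀ {n} (g : Fin n → Carrier) j → φ g (e j) ≡ g j
  φ-e {suc n} g zero    = trans (cong₂ _∙_ (identityʳ (g zero)) φ-0) (identityʳ _)
    where
    φ-0 : φ (g ∘ suc) (tail (e zero)) ≡ ε
    φ-0 = trans (IsHomomorphism.cong-≗ (φ-homomorphism (g ∘ suc)) (λ i → refl))
                (IsHomomorphism.homo-0 (φ-homomorphism (g ∘ suc)))
  φ-e {suc n} g (suc j) = trans (identityˡ _) (φ-e (g ∘ suc) j)

module SphereImage (G : FinAbGroup) where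
  open Homomorphisms G public

  φ₂⁺ : ∀ {n} → (Fin n → Carrier) → Carrier → S₂⁺ n → Carrier
  φ₂⁺ g x (inj₁ tt)              = x ∙ x
  φ₂⁺ g x (inj₂ (inj₁ tt))       = x
  φ₂⁺ g x (inj₂ (inj₂ (inj₁ j))) = x ∙ g j
  φ₂⁺ g x (inj₂ (inj₂ (inj₂ j))) = x ∙ (g j ⁻¹)

  φ₂ : ∀ {n} → (Fin n → Carrier) → S₂ n → Carrier
  φ₂ {zero}  g _               = ε
  φ₂ {suc n} g (inj₁ a)        = φ₂ (g ∘ suc) a
  φ₂ {suc n} g (inj₂ (inj₁ c)) = φ₂⁺ (g ∘ suc) (g zero) c
  φ₂ {suc n} g (inj₂ (inj₂ c)) = φ₂⁺ (g ∘ suc) (g zero ⁻¹) c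

  module _ {n} (g : Fin n → Carrier) {r : ℤ^ (suc n) → Carrier} (hom : IsHomomorphism r)
           (r-e : ∀ j → r (+ 0 ∷ e j) ≡ g j) (u : ℤ) {x : Carrier} (r-u : r (u ·e zero) ≡ x) where
    open IsHomomorphism hom

    private
      r-∷ : ∀ y → r (u ∷ y) ≡ x ∙ r (+ 0 ∷ y)
      r-∷ y = trans (cong-≗ (∷≗·e+0∷ u y)) (trans (homo-+ _ _) (cong (_∙ r (+ 0 ∷ y)) r-u))

    φ₂⁺-hom : ∀ c → φ₂⁺ g x c ≡ r (vec₂⁺ u c)
    φ₂⁺-hom (inj₁ tt) =
      sym (trans (cong-≗ (λ { zero → refl ; (suc i) → refl }))
                 (trans (homo-+ (u ·e zero) (u ·e zero)) (cong₂ _∙_ r-u r-u)))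
    φ₂⁺-hom (inj₂ (inj₁ tt)) = sym (trans (cong-≗ (λ { zero → refl ; (suc i) → refl })) r-u)
    φ₂⁺-hom (inj₂ (inj₂ (inj₁ j))) = sym (trans (r-∷ (+ 1 ·e j)) (cong (x ∙_) (r-e j)))
    φ₂⁺-hom (inj₂ (inj₂ (inj₂ j))) =
      sym (trans (r-∷ (-1ℤ ·e j))
                 (cong (x ∙_) (trans (IsHomomorphism.homo-−e (tail-homomorphism hom) j) (cong _⁻¹ (r-e j)))))

  tail-e : ∀ {n} {g : Fin (suc n) → Carrier} {r : ℤ^ (suc n) → Carrier} → IsHomomorphism r →
           (∀ j → r (e j) ≡ g j) → ∀ j → r (+ 0 ∷ e j) ≡ g (suc j)
  tail-e hom r-e j = trans (IsHomomorphism.cong-≗ hom (λ { zero → refl ; (suc i) → refl })) (r-e (suc j))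

  φ₂-hom : ∀ {n} (g : Fin n → Carrier) (r : ℤ^ n → Carrier) → IsHomomorphism r →
           (∀ j → r (e j) ≡ g j) → ∀ a → φ₂ g a ≡ r (vec₂ a)
  φ₂-hom {zero} g r hom r-e a = sym (trans (IsHomomorphism.cong-≗ hom (λ ())) (IsHomomorphism.homo-0 hom))
  φ₂-hom {suc n} g r hom r-e (inj₁ a) =
    φ₂-hom (g ∘ suc) (λ x → r (+ 0 ∷ x)) (tail-homomorphism hom) (tail-e hom r-e) a
  φ₂-hom {suc n} g r hom r-e (inj₂ (inj₁ c)) =
    φ₂⁺-hom (g ∘ suc) hom (tail-e hom r-e) (+ 1) (r-e zero) c
  φ₂-hom {suc n} g r hom r-e (inj₂ (inj₂ c)) =
    φ₂⁺-hom (g ∘ suc) hom (tail-e hom r-e) -1ℤ (trans (IsHomomorphism.homo-−e hom zero) (cong _⁻¹ (r-e zero))) c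

  Σ₁ : ∀ {n} → (Fin n → Carrier) → (Carrier → ℤ) → ℤ
  Σ₁ {n} g F = F ε + ΣFin n (λ i → F (g i) + F (g i ⁻¹))

  Σ₂ : ∀ {n} → (Fin n → Carrier) → (Carrier → ℤ) → ℤ
  Σ₂ {n} g F = Enumeration.sum (S₂-enumeration n) (λ a → F (φ₂ g a))

  Σ₁-cong : ∀ {n} (g : Fin n → Carrier) {F F′ : Carrier → ℤ} → (∀ x → F x ≡ F′ x) → Σ₁ g F ≡ Σ₁ g F′
  Σ₁-cong {n} g F≗F′ = cong₂ _+_ (F≗F′ ε) (ΣFin-cong n (λ i → cong₂ _+_ (F≗F′ (g i)) (F≗F′ (g i ⁻¹))))

  Σ₁-distrib-+ : ∀ {n} (g : Fin n → Carrier) (F F′ : Carrier → ℤ) →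
    Σ₁ g (λ x → F x + F′ x) ≡ Σ₁ g F + Σ₁ g F′
  Σ₁-distrib-+ {n} g F F′ = begin
    (F ε + F′ ε) + ΣFin n (λ i → (F (g i) + F′ (g i)) + (F (g i ⁻¹) + F′ (g i ⁻¹)))
      ≡⟨ cong (_+_ (F ε + F′ ε)) (ΣFin-cong n (λ i → +-interchange (F (g i)) _ _ _)) ⟩
    (F ε + F′ ε) + ΣFin n (λ i → (F (g i) + F (g i ⁻¹)) + (F′ (g i) + F′ (g i ⁻¹)))
      ≡⟨ cong (_+_ (F ε + F′ ε)) (ΣFin-distrib-+ n _ _) ⟩
    (F ε + F′ ε) + (ΣFin n (λ i → F (g i) + F (g i ⁻¹)) + ΣFin n (λ i → F′ (g i) + F′ (g i ⁻¹)))
      ≡⟨ +-interchange (F ε) _ _ _ ⟩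
    Σ₁ g F + Σ₁ g F′ ∎
    where
    open ≡-Reasoning
    +-interchange : ∀ a b c d → (a + b) + (c + d) ≡ (a + c) + (b + d)
    +-interchange = solve-∀

  Σ₁-suc : ∀ {n} (g : Fin (suc n) → Carrier) F →
    Σ₁ g F ≡ Σ₁ (g ∘ suc) F + (F (g zero) + F (g zero ⁻¹))
  Σ₁-suc g F = rotate (F ε) (F (g zero) + F (g zero ⁻¹)) _
    where
    rotate : ∀ a b c → a + (b + c) ≡ (a + c) + b
    rotate = solve-∀

  Σ₂⁺ : ∀ {n} (g : Fin n → Carrier) x (F : Carrier → ℤ) →
    Enumeration.sum (S₂⁺-enumeration n) (λ c → F (φ₂⁺ g x c)) ≡ F (x ∙ x) + Σ₁ g (λ y → F (x ∙ y))
  Σ₂⁺ {n} g x F = begin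
    sum (S₂⁺-enumeration n) F′
      ≡⟨ sum-⊎ ⊤-enumeration (S₁-enumeration n) F′ ⟩
    sum ⊤-enumeration (F′ ∘ inj₁) + sum (S₁-enumeration n) (F′ ∘ inj₂)
      ≡⟨ cong₂ _+_ (sum-⊤ (F′ ∘ inj₁)) (sum-⊎ ⊤-enumeration ±Fin (F′ ∘ inj₂)) ⟩
    F (x ∙ x) + (sum ⊤-enumeration (F′ ∘ inj₂ ∘ inj₁) + sum ±Fin (F′ ∘ inj₂ ∘ inj₂))
      ≡⟨ cong₂ (λ a b → F (x ∙ x) + (a + b)) (trans (sum-⊤ (F′ ∘ inj₂ ∘ inj₁)) (cong F (sym (identityʳ x))))
                                               (sum-⊎ (Fin-enumeration n) (Fin-enumeration n) (F′ ∘ inj₂ ∘ inj₂)) ⟩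
    F (x ∙ x) + (F (x ∙ ε) + (ΣFin n (λ i → F (x ∙ g i)) + ΣFin n (λ i → F (x ∙ (g i ⁻¹)))))
      ≡⟨ cong (λ s → F (x ∙ x) + (F (x ∙ ε) + s)) (ΣFin-distrib-+ n (λ i → F (x ∙ g i)) (λ i → F (x ∙ (g i ⁻¹)))) ⟨
    F (x ∙ x) + Σ₁ g (λ y → F (x ∙ y)) ∎
    where
    open ≡-Reasoning
    open Enumeration using (sum)
    F′ : S₂⁺ n → ℤ
    F′ c = F (φ₂⁺ g x c)
    ±Fin = Fin-enumeration n ⊎-enumeration Fin-enumeration n

  Σ₂-suc : ∀ {n} (g : Fin (suc n) → Carrier) (F : Carrier → ℤ) →
    let x = g zero in
    Σ₂ g F ≡ Σ₂ (g ∘ suc) F + ((F (x ∙ x) + Σ₁ (g ∘ suc) (λ y → F (x ∙ y))) +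
                               (F ((x ⁻¹) ∙ (x ⁻¹)) + Σ₁ (g ∘ suc) (λ y → F ((x ⁻¹) ∙ y))))
  Σ₂-suc {n} g F =
    trans (sum-⊎ (S₂-enumeration n) (S₂⁺-enumeration n ⊎-enumeration S₂⁺-enumeration n) (λ a → F (φ₂ g a)))
      (cong (_+_ (Σ₂ (g ∘ suc) F))
        (trans (sum-⊎ (S₂⁺-enumeration n) (S₂⁺-enumeration n) (λ c → F (φ₂ g (inj₂ c))))
               (cong₂ _+_ (Σ₂⁺ (g ∘ suc) (g zero) F) (Σ₂⁺ (g ∘ suc) (g zero ⁻¹) F))))

  -- For T = 1 + Σᵢ (gᵢ + gᵢ⁻¹) ∈ ℤ[G] this is the identity T² + T⁽²⁾ = 2 φ(S(n,2)) + 2n.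
  pairs+squares : ∀ {n} (g : Fin n → Carrier) (F : Carrier → ℤ) →
    Σ₁ g (λ a → Σ₁ g (λ b → F (a ∙ b))) + Σ₁ g (λ a → F (a ∙ a)) ≡ + 2 * Σ₂ g F + + (2 ℕ.* n) * F ε
  pairs+squares {zero} g F = trans (cong (λ y → ((y + + 0) + + 0) + (y + + 0)) (cong F (identityˡ ε)))
                                   (base (F ε))
    where
    base : ∀ f → ((f + + 0) + + 0) + (f + + 0) ≡ + 2 * (f + + 0) + + 0 * f
    base = solve-∀
  pairs+squares {suc n} g F = begin
    Σ₁ g (λ a → Σ₁ g (λ b → F (a ∙ b))) + Σ₁ g (λ a → F (a ∙ a))
      ≡⟨ cong₂ _+_ pairs-suc (Σ₁-suc g (λ a → F (a ∙ a))) ⟩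
    (P + (A + B)) + ((A + B) + ((X + F (x ∙ x̄)) + (F (x̄ ∙ x) + Y))) + (Q + (X + Y))
      ≡⟨ cong₂ (λ u v → (P + (A + B)) + ((A + B) + ((X + F u) + (F v + Y))) + (Q + (X + Y)))
               (inverseʳ x) (inverseˡ x) ⟩
    (P + (A + B)) + ((A + B) + ((X + F ε) + (F ε + Y))) + (Q + (X + Y))
      ≡⟨ regroup P Q A B X Y (F ε) ⟩
    (P + Q) + + 2 * (A + B + X + Y + F ε)
      ≡⟨ cong (_+ + 2 * (A + B + X + Y + F ε)) (pairs+squares (g ∘ suc) F) ⟩
    (+ 2 * S + + (2 ℕ.* n) * F ε) + + 2 * (A + B + X + Y + F ε)
      ≡⟨ collect S A B X Y (F ε) (+ (2 ℕ.* n)) ⟩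
    + 2 * (S + ((X + A) + (Y + B))) + (+ (2 ℕ.* n) + + 2) * F ε
      ≡⟨ cong₂ (λ u v → + 2 * u + v * F ε) (Σ₂-suc g F) (cong +_ (two-suc n)) ⟨
    + 2 * Σ₂ g F + + (2 ℕ.* suc n) * F ε ∎
    where
    open ≡-Reasoning
    x x̄ : Carrier
    x = g zero
    x̄ = x ⁻¹
    g′ : Fin n → Carrier
    g′ = g ∘ suc
    P Q S A B X Y : ℤ
    P = Σ₁ g′ (λ a → Σ₁ g′ (λ b → F (a ∙ b)))
    Q = Σ₁ g′ (λ a → F (a ∙ a))
    S = Σ₂ g′ F
    A = Σ₁ g′ (λ b → F (x ∙ b))
    B = Σ₁ g′ (λ b → F (x̄ ∙ b))
    X = F (x ∙ x)
    Y = F (x̄ ∙ x̄)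
    regroup : ∀ P Q A B X Y f → (P + (A + B)) + ((A + B) + ((X + f) + (f + Y))) + (Q + (X + Y))
                                ≡ (P + Q) + + 2 * (A + B + X + Y + f)
    regroup = solve-∀
    collect : ∀ S A B X Y f c → (+ 2 * S + c * f) + + 2 * (A + B + X + Y + f)
                                ≡ + 2 * (S + ((X + A) + (Y + B))) + (c + + 2) * f
    collect = solve-∀
    two-suc : ∀ n → 2 ℕ.* suc n ≡ 2 ℕ.* n ℕ.+ 2
    two-suc = ℕSolver.solve-∀
    pairs-suc : Σ₁ g (λ a → Σ₁ g (λ b → F (a ∙ b)))
                ≡ (P + (A + B)) + ((A + B) + ((X + F (x ∙ x̄)) + (F (x̄ ∙ x) + Y)))
    pairs-suc = begin
      Σ₁ g (λ a → Σ₁ g (λ b → F (a ∙ b)))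
        ≡⟨ Σ₁-cong g (λ a → Σ₁-suc g (λ b → F (a ∙ b))) ⟩
      Σ₁ g (λ a → Σ₁ g′ (λ b → F (a ∙ b)) + (F (a ∙ x) + F (a ∙ x̄)))
        ≡⟨ Σ₁-distrib-+ g (λ a → Σ₁ g′ (λ b → F (a ∙ b))) (λ a → F (a ∙ x) + F (a ∙ x̄)) ⟩
      Σ₁ g (λ a → Σ₁ g′ (λ b → F (a ∙ b))) + Σ₁ g (λ a → F (a ∙ x) + F (a ∙ x̄))
        ≡⟨ cong₂ _+_ (Σ₁-suc g (λ a → Σ₁ g′ (λ b → F (a ∙ b)))) (Σ₁-suc g (λ a → F (a ∙ x) + F (a ∙ x̄))) ⟩
      (P + (A + B)) + (Σ₁ g′ (λ a → F (a ∙ x) + F (a ∙ x̄)) + ((X + F (x ∙ x̄)) + (F (x̄ ∙ x) + Y)))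
        ≡⟨ cong (λ s → (P + (A + B)) + (s + ((X + F (x ∙ x̄)) + (F (x̄ ∙ x) + Y))))
             (trans (Σ₁-cong g′ (λ a → cong₂ _+_ (cong F (comm a x)) (cong F (comm a x̄))))
                    (Σ₁-distrib-+ g′ (λ b → F (x ∙ b)) (λ b → F (x̄ ∙ b)))) ⟩
      (P + (A + B)) + ((A + B) + ((X + F (x ∙ x̄)) + (F (x̄ ∙ x) + Y))) ∎

  ΣG-Σ₁-δ : ∀ {n} (g : Fin n → Carrier) (f : Carrier → ℤ) → ΣG (λ k → Σ₁ g (λ a → δ a k) * f k) ≡ Σ₁ g f
  ΣG-Σ₁-δ {n} g f = begin
    ΣG (λ k → Σ₁ g (λ a → δ a k) * f k)
      ≡⟨ sum-cong (λ k → trans (ℤₚ.*-distribʳ-+ (f k) (δ ε k) (ΣFin n (λ i → δ (g i) k + δ (g i ⁻¹) k)))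
                               (cong (_+_ (δ ε k * f k)) (trans (sym (ΣFin-*ʳ n (λ i → δ (g i) k + δ (g i ⁻¹) k) (f k)))
                                 (ΣFin-cong n (λ i → ℤₚ.*-distribʳ-+ (f k) (δ (g i) k) (δ (g i ⁻¹) k)))))) ⟩
    ΣG (λ k → δ ε k * f k + ΣFin n (λ i → δ (g i) k * f k + δ (g i ⁻¹) k * f k))
      ≡⟨ sum-distrib-+ (λ k → δ ε k * f k) (λ k → ΣFin n (λ i → δ (g i) k * f k + δ (g i ⁻¹) k * f k)) ⟩
    ΣG (λ k → δ ε k * f k) + ΣG (λ k → ΣFin n (λ i → δ (g i) k * f k + δ (g i ⁻¹) k * f k))
      ≡⟨ cong₂ _+_ (δʳ ε) (trans (sum-comm-ΣFin n (λ k i → δ (g i) k * f k + δ (g i ⁻¹) k * f k))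
           (ΣFin-cong n (λ i → trans (sum-distrib-+ (λ k → δ (g i) k * f k) (λ k → δ (g i ⁻¹) k * f k))
                                     (cong₂ _+_ (δʳ (g i)) (δʳ (g i ⁻¹)))))) ⟩
    Σ₁ g f ∎
    where
    open ≡-Reasoning
    δʳ : ∀ a → ΣG (λ k → δ a k * f k) ≡ f a
    δʳ a = trans (sum-cong (λ k → cong (_* f k) (δ-sym a k))) (ΣG-δˡ a f)

  module GroupRingOfΣ₁ {n} (g : Fin n → Carrier) (T : Carrier → Bool)
                       (T≡Σ₁ : ∀ h → ⟦ T ⟧ h ≡ Σ₁ g (λ a → δ a h)) where

    ⟦T⟧⁽_⁾≡Σ₁ : ∀ t h → (⟦ T ⟧ ⁽ t ⁾) h ≡ Σ₁ g (λ a → δ (a ^ t) h)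
    ⟦T⟧⁽ t ⁾≡Σ₁ h = trans (sum-cong (λ k → cong (_* δ (k ^ t) h) (T≡Σ₁ k))) (ΣG-Σ₁-δ g (λ k → δ (k ^ t) h))

    ⟦T⟧⁽-1⁾≡Σ₁ : ∀ h → (⟦ T ⟧ ⁽ -[1+ 0 ] ⁾) h ≡ Σ₁ g (λ a → δ (a ⁻¹) h)
    ⟦T⟧⁽-1⁾≡Σ₁ h = trans (⟦T⟧⁽ -[1+ 0 ] ⁾≡Σ₁ h) (Σ₁-cong g (λ a → cong (λ y → δ (y ⁻¹) h) (identityʳ a)))

    ⟦T⟧⁽2⁾≡Σ₁ : ∀ h → (⟦ T ⟧ ⁽ + 2 ⁾) h ≡ Σ₁ g (λ a → δ (a ∙ a) h)
    ⟦T⟧⁽2⁾≡Σ₁ h = trans (⟦T⟧⁽ + 2 ⁾≡Σ₁ h) (Σ₁-cong g (λ a → cong (λ y → δ (a ∙ y) h) (identityʳ a)))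

    ⟦T⟧²≡Σ₁Σ₁ : ∀ h → (⟦ T ⟧ *ᴳ ⟦ T ⟧) h ≡ Σ₁ g (λ a → Σ₁ g (λ b → δ (a ∙ b) h))
    ⟦T⟧²≡Σ₁Σ₁ h = trans (sum-cong (λ k → cong (_* ⟦ T ⟧ ((k ⁻¹) ∙ h)) (T≡Σ₁ k)))
      (trans (ΣG-Σ₁-δ g (λ k → ⟦ T ⟧ ((k ⁻¹) ∙ h)))
             (Σ₁-cong g (λ a → trans (T≡Σ₁ ((a ⁻¹) ∙ h))
                                     (Σ₁-cong g (λ b → δ-cong-⇔ ∙-solveʳ (y≈x\\z a b h))))))

    square-equation⇔unique-preimage : ∀ h →
      (⟦ T ⟧ *ᴳ ⟦ T ⟧) h ≡ ((((+ 2) ·ᴳ wholeG) -ᴳ (⟦ T ⟧ ⁽ + 2 ⁾)) +ᴳ ⟦ + (2 ℕ.* n) ⟧ℤ) h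
      ⇔ Σ₂ g (λ x → δ x h) ≡ + 1
    square-equation⇔unique-preimage h =
      subst₂ (λ P Q → P ≡ (+ 2 * + 1 - Q) + d ⇔ Σ₂ g (λ x → δ x h) ≡ + 1)
             (sym (⟦T⟧²≡Σ₁Σ₁ h)) (sym (⟦T⟧⁽2⁾≡Σ₁ h))
             (P+Q≡2S+d⇒[P≡2-Q+d⇔S≡1] _ _ _ d
               (trans (pairs+squares g (λ x → δ x h)) (cong (λ y → + 2 * Σ₂ g (λ x → δ x h) + + (2 ℕ.* n) * y) (δ-sym ε h))))
      where
      d : ℤ
      d = + (2 ℕ.* n) * δ h ε

  Σ₁-≥-ε : ∀ {n} (g : Fin n → Carrier) (F : Carrier → ℤ) → (∀ x → + 0 ≤ F x) → F ε ≤ Σ₁ g F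
  Σ₁-≥-ε {n} g F F≥0 = i≤i+j (F ε) (ΣFin-nonneg n _ (λ i → ℤₚ.+-mono-≤ (F≥0 (g i)) (F≥0 (g i ⁻¹))))

  Σ₁≤Σ₂ : ∀ {n} (g : Fin n → Carrier) (F : Carrier → ℤ) → (∀ x → + 0 ≤ F x) → Σ₁ g F ≤ Σ₂ g F
  Σ₁≤Σ₂ {zero}  g F F≥0 = ℤₚ.≤-refl
  Σ₁≤Σ₂ {suc n} g F F≥0 = begin
    Σ₁ g F                                ≡⟨ Σ₁-suc g F ⟩
    Σ₁ g′ F + (F x + F (x ⁻¹))            ≤⟨ ℤₚ.+-mono-≤ (Σ₁≤Σ₂ g′ F F≥0) (ℤₚ.+-mono-≤ (≤-half x) (≤-half (x ⁻¹))) ⟩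
    Σ₂ g′ F + ((F (x ∙ x) + Σ₁ g′ (λ b → F (x ∙ b))) + (F ((x ⁻¹) ∙ (x ⁻¹)) + Σ₁ g′ (λ b → F ((x ⁻¹) ∙ b))))
                                          ≡⟨ Σ₂-suc g F ⟨
    Σ₂ g F                                ∎
    where
    open ℤₚ.≤-Reasoning
    x : Carrier
    x = g zero
    g′ : Fin n → Carrier
    g′ = g ∘ suc
    ≤-half : ∀ y → F y ≤ F (y ∙ y) + Σ₁ g′ (λ b → F (y ∙ b))
    ≤-half y = ℤₚ.≤-trans (ℤₚ.≤-reflexive (cong F (sym (identityʳ y))))
               (ℤₚ.≤-trans (Σ₁-≥-ε g′ (λ b → F (y ∙ b)) (λ b → F≥0 (y ∙ b)))
                           (subst (Σ₁ g′ (λ b → F (y ∙ b)) ≤_) (ℤₚ.+-comm _ (F (y ∙ y)))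
                                  (i≤i+j _ (F≥0 (y ∙ y)))))

  module Image₁ {n} (g : Fin n → Carrier) (unique : ∀ h → Σ₂ g (λ x → δ x h) ≡ + 1) where

    image₁ : Carrier → Bool
    image₁ h = nonzero? (Σ₁ g (λ a → δ a h))

    -- Σ₁ ≤ Σ₂ = 1 pointwise: the elements 1, g j, g j⁻¹ are pairwise distinct.
    ⟦image₁⟧≡Σ₁ : ∀ h → ⟦ image₁ ⟧ h ≡ Σ₁ g (λ a → δ a h)
    ⟦image₁⟧≡Σ₁ h = 𝟙-nonzero? _ (ℤₚ.≤-trans (δ-nonneg ε h) (Σ₁-≥-ε g (λ a → δ a h) (λ a → δ-nonneg a h)))
                                 (subst (Σ₁ g (λ a → δ a h) ≤_) (unique h) (Σ₁≤Σ₂ g (λ a → δ a h) (λ a → δ-nonneg a h)))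

    open GroupRingOfΣ₁ g image₁ ⟦image₁⟧≡Σ₁

    ε∈image₁ : image₁ ε ≡ true
    ε∈image₁ = nonzero?-pos _ (ℤₚ.≤-trans (ℤₚ.≤-reflexive (sym (δ-≡ refl)))
                                          (Σ₁-≥-ε g (λ a → δ a ε) (λ a → δ-nonneg a ε)))

    image₁-symmetric : ⟦ image₁ ⟧ ≈ᴳ (⟦ image₁ ⟧ ⁽ -[1+ 0 ] ⁾)
    image₁-symmetric h = trans (⟦image₁⟧≡Σ₁ h) (sym (trans (⟦T⟧⁽-1⁾≡Σ₁ h)
      (cong₂ _+_ (cong (λ y → δ y h) ε⁻¹≈ε)
                 (ΣFin-cong n (λ i → trans (ℤₚ.+-comm (δ (g i ⁻¹) h) _)
                                           (cong (λ y → δ y h + δ (g i ⁻¹) h) (⁻¹-involutive (g i))))))))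

    image₁-square : (⟦ image₁ ⟧ *ᴳ ⟦ image₁ ⟧) ≈ᴳ
                    ((((+ 2) ·ᴳ wholeG) -ᴳ (⟦ image₁ ⟧ ⁽ + 2 ⁾)) +ᴳ ⟦ + (2 ℕ.* n) ⟧ℤ)
    image₁-square h = Equivalence.from (square-equation⇔unique-preimage h) (unique h)

-- From a code to a group

module Quotient (n : ℕ) (C : ℤ^ n → Set) (perfect : IsLinearPLCode n 2 C) where
  open IsLinearPLCode perfect
  open IsSubgroup subgroup

  record _~_ (x y : ℤ^ n) : Set where
    constructor ⟨_⟩
    field difference∈C : C (x ⊖ y)
  open _~_

  ≗⇒~ : ∀ {x y} → x ≗ᵥ y → x ~ y
  ≗⇒~ {x} {y} x≗y = ⟨ respects (λ i → trans (sym (ℤₚ.+-inverseʳ (x i))) (cong (_-_ (x i)) (x≗y i))) has-zero ⟩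

  ~-refl : ∀ {x} → x ~ x
  ~-refl = ≗⇒~ (λ i → refl)

  ~-sym : ∀ {x y} → x ~ y → y ~ x
  ~-sym {x} {y} ⟨ x-y∈C ⟩ = ⟨ respects (λ i → neg-sub (x i) (y i)) (closed-- x-y∈C) ⟩
    where
    neg-sub : ∀ a b → - (a - b) ≡ b - a
    neg-sub = solve-∀

  ~-trans : ∀ {x y z} → x ~ y → y ~ z → x ~ z
  ~-trans {x} {y} {z} ⟨ x-y∈C ⟩ ⟨ y-z∈C ⟩ = ⟨ respects (λ i → telescope (x i) (y i) (z i)) (closed-+ x-y∈C y-z∈C) ⟩
    where
    telescope : ∀ a b c → (a - b) + (b - c) ≡ a - c
    telescope = solve-∀

  ~-+ : ∀ {x x′ y y′} → x ~ x′ → y ~ y′ → (x +ᵥ y) ~ (x′ +ᵥ y′)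
  ~-+ {x} {x′} {y} {y′} ⟨ p ⟩ ⟨ q ⟩ = ⟨ respects (λ i → sub-+ (x i) (x′ i) (y i) (y′ i)) (closed-+ p q) ⟩
    where
    sub-+ : ∀ a b c d → (a - b) + (c - d) ≡ (a + c) - (b + d)
    sub-+ = solve-∀

  ~-neg : ∀ {x x′} → x ~ x′ → (-ᵥ x) ~ (-ᵥ x′)
  ~-neg {x} {x′} ⟨ p ⟩ = ⟨ respects (λ i → neg-sub (x i) (x′ i)) (closed-- p) ⟩
    where
    neg-sub : ∀ a b → - (a - b) ≡ (- a) - (- b)
    neg-sub = solve-∀

  center : ℤ^ n → ℤ^ n
  center x = proj₁ (cover x)

  center∈C : ∀ x → C (center x)
  center∈C x = proj₁ (proj₂ (cover x))

  x⊖center∈S : ∀ x → (x ⊖ center x) ∈S[ 2 ]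
  x⊖center∈S x = proj₂ (proj₂ (cover x))

  rep : ℤ^ n → S₂ n
  rep x = code₂ (x ⊖ center x)

  ~-rep : ∀ x → x ~ vec₂ (rep x)
  ~-rep x = ⟨ respects (λ i → sym (trans (cong (_-_ (x i)) (vec₂-code₂ (x ⊖ center x) (x⊖center∈S x) i))
                                          (x-[x-y]≡y (x i) (center x i))))
                       (center∈C x) ⟩

  rep-unique : ∀ x a → x ~ vec₂ a → rep x ≡ a
  rep-unique x a x~a =
    trans (code₂-cong (λ i → trans (cong (_-_ (x i)) (center≗x⊖a i)) (x-[x-y]≡y (x i) (vec₂ a i))))
          (code₂-vec₂ a)
    where
    x⊖[x⊖a]∈S : (x ⊖ (x ⊖ vec₂ a)) ∈S[ 2 ]
    x⊖[x⊖a]∈S = subst (ℕ._≤ 2) (sym (leeNorm-cong (λ i → x-[x-y]≡y (x i) (vec₂ a i)))) (leeNorm-vec₂ a)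
    center≗x⊖a : center x ≗ᵥ (x ⊖ vec₂ a)
    center≗x⊖a = disjoint x (center x) (x ⊖ vec₂ a) (center∈C x) (difference∈C x~a) (x⊖center∈S x) x⊖[x⊖a]∈S

  rep-cong : ∀ {x y} → x ~ y → rep x ≡ rep y
  rep-cong {x} {y} x~y = rep-unique x (rep y) (~-trans x~y (~-rep y))

  _·_ : S₂ n → S₂ n → S₂ n
  a · b = rep (vec₂ a +ᵥ vec₂ b)

  𝟎 : S₂ n
  𝟎 = rep 0ᵥ

  _⁻ : S₂ n → S₂ n
  a ⁻ = rep (-ᵥ vec₂ a)

  ·-assoc : ∀ a b c → (a · b) · c ≡ a · (b · c)
  ·-assoc a b c = rep-cong (~-trans (~-+ (~-sym (~-rep (vec₂ a +ᵥ vec₂ b))) (~-refl {vec₂ c}))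
                           (~-trans (≗⇒~ (λ i → ℤₚ.+-assoc (vec₂ a i) (vec₂ b i) (vec₂ c i)))
                                    (~-+ (~-refl {vec₂ a}) (~-rep (vec₂ b +ᵥ vec₂ c)))))

  ·-comm : ∀ a b → a · b ≡ b · a
  ·-comm a b = rep-cong (≗⇒~ (λ i → ℤₚ.+-comm (vec₂ a i) (vec₂ b i)))

  ·-identityˡ : ∀ a → 𝟎 · a ≡ a
  ·-identityˡ a = rep-unique _ a (~-trans (~-+ (~-sym (~-rep 0ᵥ)) (~-refl {vec₂ a}))
                                          (≗⇒~ (λ i → ℤₚ.+-identityˡ (vec₂ a i))))

  ·-inverseˡ : ∀ a → (a ⁻) · a ≡ 𝟎
  ·-inverseˡ a = rep-cong (~-trans (~-+ (~-sym (~-rep (-ᵥ vec₂ a))) (~-refl {vec₂ a}))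
                                   (≗⇒~ (λ i → ℤₚ.+-inverseˡ (vec₂ a i))))

  isAbelianGroup : IsAbelianGroup _≡_ _·_ 𝟎 _⁻
  isAbelianGroup = record
    { isGroup = record
      { isMonoid = record
        { isSemigroup = record
          { isMagma = record { isEquivalence = isEquivalence ; ∙-cong = cong₂ _·_ }
          ; assoc = ·-assoc }
        ; identity = ·-identityˡ , (λ a → trans (·-comm a 𝟎) (·-identityˡ a)) }
      ; inverse = ·-inverseˡ , (λ a → trans (·-comm a (a ⁻)) (·-inverseˡ a))
      ; ⁻¹-cong = cong _⁻ }
    ; comm = ·-comm }

  ℤⁿ/C : FinAbGroup
  ℤⁿ/C = record
    { Carrier = S₂ n ; _∙_ = _·_ ; ε = 𝟎 ; _⁻¹ = _⁻ ; isAbelianGroup = isAbelianGroup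
    ; order = Enumeration.size (S₂-enumeration n) ; enum = Enumeration.enum (S₂-enumeration n) }

  open SphereImage ℤⁿ/C using (IsHomomorphism; φ₂; φ₂-hom; Σ₂; δ; δ-≡; δ-≢; module Image₁)

  rep-homomorphism : IsHomomorphism rep
  rep-homomorphism = record
    { cong-≗ = λ x≗y → rep-cong (≗⇒~ x≗y)
    ; homo-+ = λ x y → rep-cong (~-+ (~-rep x) (~-rep y))
    ; homo-- = λ x → rep-cong (~-neg (~-rep x)) }

  generators : Fin n → S₂ n
  generators j = rep (e j)

  φ₂-generators : ∀ a → φ₂ generators a ≡ a
  φ₂-generators a = trans (φ₂-hom generators rep rep-homomorphism (λ j → refl) a)
                          (rep-unique _ a ~-refl)

  unique-preimage : ∀ h → Σ₂ generators (λ x → δ x h) ≡ + 1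
  unique-preimage h = trans (sum-cong (λ a → sym (ℤₚ.*-identityʳ (d a))))
    (sum-select h d (λ _ → + 1) (trans (cong (λ y → δ y h) (φ₂-generators h)) (δ-≡ refl))
                                (λ a a≢h → trans (cong (λ y → δ y h) (φ₂-generators a)) (δ-≢ a≢h)))
    where
    open Enumeration (S₂-enumeration n) using (sum-cong; sum-select)
    d : S₂ n → ℤ
    d a = δ (φ₂ generators a) h

  open Image₁ generators unique-preimage public

-- From a group to a code

module Generators (G : FinAbGroup) (n : ℕ) where
  open SphereImage G

  module _ (∣G∣ : order ≡ 2 ℕ.* n ℕ.* n ℕ.+ 2 ℕ.* n ℕ.+ 1)
           (T : Carrier → Bool)
           (ε∈T : T ε ≡ true)
           (T-symmetric : ⟦ T ⟧ ≈ᴳ (⟦ T ⟧ ⁽ -[1+ 0 ] ⁾))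
           (T-square : (⟦ T ⟧ *ᴳ ⟦ T ⟧) ≈ᴳ ((((+ 2) ·ᴳ wholeG) -ᴳ (⟦ T ⟧ ⁽ + 2 ⁾)) +ᴳ ⟦ + (2 ℕ.* n) ⟧ℤ))
           where

    involution-free : ∀ a → a ∙ a ≡ ε → a ≡ ε
    involution-free = odd-order⇒involution-free (n ℕ.* n ℕ.+ n) (trans ∣G∣ (odd n))
      where
      odd : ∀ n → 2 ℕ.* n ℕ.* n ℕ.+ 2 ℕ.* n ℕ.+ 1 ≡ suc ((n ℕ.* n ℕ.+ n) ℕ.+ (n ℕ.* n ℕ.+ n))
      odd = ℕSolver.solve-∀

    ⟦T⟧-inverse : ∀ h → ⟦ T ⟧ h ≡ ⟦ T ⟧ (h ⁻¹)
    ⟦T⟧-inverse h = trans (T-symmetric h) (trans (sum-cong (λ k → cong (⟦ T ⟧ k *_)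
                      (δ-cong-⇔ {(k ∙ ε) ⁻¹} {h} {k} {h ⁻¹}
                        (λ k⁻¹≡h → trans (sym (⁻¹-involutive k)) (cong _⁻¹ (trans (cong _⁻¹ (sym (identityʳ k))) k⁻¹≡h)))
                        (λ k≡h⁻¹ → trans (cong _⁻¹ (identityʳ k)) (trans (cong _⁻¹ k≡h⁻¹) (⁻¹-involutive h))))))
                    (ΣG-δʳ (h ⁻¹) ⟦ T ⟧))

    T-inverse : ∀ h → T (h ⁻¹) ≡ T h
    T-inverse h = 𝟙-injective (sym (⟦T⟧-inverse h))
      where
      𝟙-injective : ∀ {a b} → 𝟙 a ≡ 𝟙 b → a ≡ b
      𝟙-injective {false} {false} _ = refl
      𝟙-injective {true}  {true}  _ = refl
      𝟙-injective {false} {true}  ()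
      𝟙-injective {true}  {false} ()

    -- Evaluate T-square at ε; T⁽²⁾ has ε-coefficient 1 since G has no involutions.
    ∣T∣ : ΣG ⟦ T ⟧ ≡ + 1 + + (2 ℕ.* n)
    ∣T∣ = trans (sym T²-at-ε) (trans (T-square ε) rhs-at-ε)
      where
      ⟦T⟧-idempotent : ∀ h → ⟦ T ⟧ h * ⟦ T ⟧ h ≡ ⟦ T ⟧ h
      ⟦T⟧-idempotent h with T h
      ... | true  = refl
      ... | false = refl
      T²-at-ε : (⟦ T ⟧ *ᴳ ⟦ T ⟧) ε ≡ ΣG ⟦ T ⟧
      T²-at-ε = sum-cong (λ k → trans (cong (λ y → ⟦ T ⟧ k * ⟦ T ⟧ y) (identityʳ (k ⁻¹)))
                                      (trans (cong (⟦ T ⟧ k *_) (sym (⟦T⟧-inverse k))) (⟦T⟧-idempotent k)))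
      T⁽²⁾-at-ε : (⟦ T ⟧ ⁽ + 2 ⁾) ε ≡ + 1
      T⁽²⁾-at-ε = trans (sum-cong (λ k → cong (⟦ T ⟧ k *_)
                          (δ-cong-⇔ {k ∙ (k ∙ ε)} {ε} {k} {ε}
                            (λ k²≡ε → involution-free k (trans (cong (k ∙_) (sym (identityʳ k))) k²≡ε))
                            (λ k≡ε → trans (cong (λ y → y ∙ (y ∙ ε)) k≡ε) (trans (identityˡ _) (identityˡ ε))))))
                        (trans (ΣG-δʳ ε ⟦ T ⟧) (cong 𝟙 ε∈T))
      rhs-at-ε : ((((+ 2) ·ᴳ wholeG) -ᴳ (⟦ T ⟧ ⁽ + 2 ⁾)) +ᴳ ⟦ + (2 ℕ.* n) ⟧ℤ) ε ≡ + 1 + + (2 ℕ.* n)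
      rhs-at-ε = cong₂ _+_ (cong (λ y → + 2 * + 1 - y) T⁽²⁾-at-ε)
                           (trans (cong (+ (2 ℕ.* n) *_) (δ-≡ refl)) (ℤₚ.*-identityʳ (+ (2 ℕ.* n))))

    -- T ∖ {ε} splits into pairs {h, h⁻¹}; P selects the member of smaller index.
    P : Carrier → Bool
    P h = T h ∧ index h <?ᵇ index (h ⁻¹)

    T-decomposition : ∀ h → ⟦ T ⟧ h ≡ δ ε h + (𝟙 (P h) + 𝟙 (P (h ⁻¹)))
    T-decomposition h with h ≟ ε
    ... | yes refl = begin
      𝟙 (T ε)                                   ≡⟨ cong 𝟙 ε∈T ⟩
      + 1 + (+ 0 + + 0)                         ≡⟨ cong₂ (λ u v → + 1 + (u + v)) (P-self (sym ε⁻¹≈ε))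
                                                         (P-self (trans ε⁻¹≈ε (sym (⁻¹-involutive ε)))) ⟨
      + 1 + (𝟙 (P ε) + 𝟙 (P (ε ⁻¹)))            ≡⟨ cong (_+ (𝟙 (P ε) + 𝟙 (P (ε ⁻¹)))) (δ-≡ refl) ⟨
      δ ε ε + (𝟙 (P ε) + 𝟙 (P (ε ⁻¹)))          ∎
      where
      open ≡-Reasoning
      P-self : ∀ {y z} → y ≡ z → 𝟙 (T y ∧ index y <?ᵇ index z) ≡ + 0
      P-self {y} refl = 𝟙-∧-<-irrefl (T y) (index y)
    ... | no  h≢ε = begin
      𝟙 (T h)                                                  ≡⟨ 𝟙-∧-<-trichotomy (T h) _ _ index-h≢index-h⁻¹ ⟨
      𝟙 (T h ∧ index h <?ᵇ index (h ⁻¹)) + 𝟙 (T h ∧ index (h ⁻¹) <?ᵇ index h)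
        ≡⟨ cong₂ (λ b y → 𝟙 (T h ∧ index h <?ᵇ index (h ⁻¹)) + 𝟙 (b ∧ index (h ⁻¹) <?ᵇ index y))
                 (T-inverse h) (⁻¹-involutive h) ⟨
      𝟙 (P h) + 𝟙 (P (h ⁻¹))                                   ≡⟨ ℤₚ.+-identityˡ _ ⟨
      + 0 + (𝟙 (P h) + 𝟙 (P (h ⁻¹)))                           ≡⟨ cong (_+ (𝟙 (P h) + 𝟙 (P (h ⁻¹)))) (δ-≢ (h≢ε ∘ sym)) ⟨
      δ ε h + (𝟙 (P h) + 𝟙 (P (h ⁻¹)))                         ∎
      where
      open ≡-Reasoning
      index-h≢index-h⁻¹ : index h ≢ index (h ⁻¹)
      index-h≢index-h⁻¹ eq = h≢ε (involution-free h (trans (cong (h ∙_) (index-injective eq)) (inverseʳ h)))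

    private
      filtered : Σ ℕ λ L → Σ (Fin L → Fin order) λ s →
                 ∀ (H : Fin order → ℤ) → ΣFin L (λ i → H (s i)) ≡ ΣFin order (λ i → 𝟙 (P (from i)) * H i)
      filtered = ΣFin-filter order (λ i → P (from i))

    L : ℕ
    L = proj₁ filtered

    P-enumeration : Fin L → Carrier
    P-enumeration i = from (proj₁ (proj₂ filtered) i)

    ΣFin-P-enumeration : ∀ (H : Carrier → ℤ) → ΣFin L (λ i → H (P-enumeration i)) ≡ ΣG (λ h → 𝟙 (P h) * H h)
    ΣFin-P-enumeration H = proj₂ (proj₂ filtered) (λ i → H (from i))

    L≡n : L ≡ n
    L≡n = m+m≡n+n⇒m≡n L n (ℕₚ.suc-injective (ℤₚ.+-injective (begin
      + (1 ℕ.+ (L ℕ.+ L))                       ≡⟨ cong₂ (λ u v → + 1 + (u + v)) ∣P∣ ∣P∣ ⟨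
      + 1 + (ΣG (𝟙 ∘ P) + ΣG (𝟙 ∘ P))           ≡⟨ cong₂ (λ u v → u + (ΣG (𝟙 ∘ P) + v))
                                                          (trans (sum-cong (λ h → δ-sym ε h)) (ΣG-δ ε))
                                                          (sum-reindex _⁻¹ _⁻¹ ⁻¹-involutive ⁻¹-involutive (𝟙 ∘ P)) ⟨
      ΣG (δ ε) + (ΣG (𝟙 ∘ P) + ΣG (λ h → 𝟙 (P (h ⁻¹))))
                                                ≡⟨ cong (_+_ (ΣG (δ ε))) (sum-distrib-+ (𝟙 ∘ P) (λ h → 𝟙 (P (h ⁻¹)))) ⟨
      ΣG (δ ε) + ΣG (λ h → 𝟙 (P h) + 𝟙 (P (h ⁻¹)))
                                                ≡⟨ sum-distrib-+ (δ ε) (λ h → 𝟙 (P h) + 𝟙 (P (h ⁻¹))) ⟨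
      ΣG (λ h → δ ε h + (𝟙 (P h) + 𝟙 (P (h ⁻¹)))) ≡⟨ sum-cong T-decomposition ⟨
      ΣG ⟦ T ⟧                                  ≡⟨ ∣T∣ ⟩
      + (1 ℕ.+ 2 ℕ.* n)                         ≡⟨ cong (λ k → + (1 ℕ.+ (n ℕ.+ k))) (ℕₚ.+-identityʳ n) ⟩
      + (1 ℕ.+ (n ℕ.+ n))                       ∎)))
      where
      open ≡-Reasoning
      ∣P∣ : ΣG (𝟙 ∘ P) ≡ + L
      ∣P∣ = trans (sum-cong (λ h → sym (ℤₚ.*-identityʳ (𝟙 (P h)))))
                  (trans (sym (ΣFin-P-enumeration (λ _ → + 1))) (ΣFin-const-1 L))

    generators : Fin n → Carrier
    generators = subst (λ k → Fin k → Carrier) L≡n P-enumeration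

    ⟦T⟧≡Σ₁ : ∀ h → ⟦ T ⟧ h ≡ Σ₁ generators (λ a → δ a h)
    ⟦T⟧≡Σ₁ h = sym (begin
      Σ₁ generators (λ a → δ a h)
        ≡⟨ cong (_+_ (δ ε h)) (ΣFin-distrib-+ n (λ i → δ (generators i) h) (λ i → δ (generators i ⁻¹) h)) ⟩
      δ ε h + (ΣFin n (λ i → δ (generators i) h) + ΣFin n (λ i → δ (generators i ⁻¹) h))
        ≡⟨ cong₂ (λ u v → δ ε h + (u + v)) (ΣFin-generators (λ a → δ a h)) (ΣFin-generators (λ a → δ (a ⁻¹) h)) ⟩
      δ ε h + (ΣG (λ k → 𝟙 (P k) * δ k h) + ΣG (λ k → 𝟙 (P k) * δ (k ⁻¹) h))
        ≡⟨ cong₂ (λ u v → δ ε h + (u + v)) (ΣG-δʳ h (𝟙 ∘ P))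
                 (trans (sum-cong (λ k → cong (𝟙 (P k) *_) (δ-cong-⇔ {k ⁻¹} {h} {k} {h ⁻¹}
                          (λ k⁻¹≡h → trans (sym (⁻¹-involutive k)) (cong _⁻¹ k⁻¹≡h))
                          (λ k≡h⁻¹ → trans (cong _⁻¹ k≡h⁻¹) (⁻¹-involutive h)))))
                        (ΣG-δʳ (h ⁻¹) (𝟙 ∘ P))) ⟩
      δ ε h + (𝟙 (P h) + 𝟙 (P (h ⁻¹)))
        ≡⟨ T-decomposition h ⟨
      ⟦ T ⟧ h ∎)
      where
      open ≡-Reasoning
      ΣFin-generators : ∀ (H : Carrier → ℤ) → ΣFin n (λ i → H (generators i)) ≡ ΣG (λ k → 𝟙 (P k) * H k)
      ΣFin-generators H = trans (ΣFin-subst L≡n P-enumeration H) (ΣFin-P-enumeration H)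

    unique-preimage : ∀ h → Σ₂ generators (λ x → δ x h) ≡ + 1
    unique-preimage h =
      Equivalence.to (GroupRingOfΣ₁.square-equation⇔unique-preimage generators T ⟦T⟧≡Σ₁ h) (T-square h)

module Kernel (G : FinAbGroup) (n : ℕ) where
  open SphereImage G public

  module _ (g : Fin n → Carrier) (unique : ∀ h → Σ₂ g (λ x → δ x h) ≡ + 1) where
    open IsHomomorphism (φ-homomorphism g)
    open Enumeration (S₂-enumeration n) using (sum-nonzero; sum-unique)

    ker : ℤ^ n → Set
    ker x = φ g x ≡ ε

    φ-⊖ : ∀ x y → φ g (x ⊖ y) ≡ φ g x ∙ (φ g y ⁻¹)
    φ-⊖ x y = trans (homo-+ x (-ᵥ y)) (cong (φ g x ∙_) (homo-- y))

    φ₂≡φ∘vec₂ : ∀ a → φ₂ g a ≡ φ g (vec₂ a)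
    φ₂≡φ∘vec₂ = φ₂-hom g (φ g) (φ-homomorphism g) (φ-e g)

    x⊖[x⊖y]≗y : ∀ (x y : ℤ^ n) → (x ⊖ (x ⊖ y)) ≗ᵥ y
    x⊖[x⊖y]≗y x y i = x-[x-y]≡y (x i) (y i)

    ker-subgroup : IsSubgroup n ker
    ker-subgroup = record
      { respects = λ x≗y φx≡ε → trans (sym (cong-≗ x≗y)) φx≡ε
      ; has-zero = homo-0
      ; closed-+ = λ {x} {y} φx≡ε φy≡ε → trans (homo-+ x y) (trans (cong₂ _∙_ φx≡ε φy≡ε) (identityˡ ε))
      ; closed-- = λ {x} φx≡ε → trans (homo-- x) (trans (cong _⁻¹ φx≡ε) ε⁻¹≈ε) }

    φ₂-surjective : ∀ h → Σ (S₂ n) (λ a → φ₂ g a ≡ h)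
    φ₂-surjective h =
      let a , δ≢0 = sum-nonzero (λ a → δ (φ₂ g a) h) (λ Σ≡0 → 1≢0 (trans (sym (unique h)) Σ≡0))
      in a , δ≢0⇒≡ δ≢0
      where
      1≢0 : + 1 ≢ + 0
      1≢0 ()

    ker-cover : ∀ x → ∃[ c ] (ker c × (x ⊖ c) ∈S[ 2 ])
    ker-cover x = x ⊖ vec₂ a , x⊖a∈ker , subst (ℕ._≤ 2) (sym (leeNorm-cong (x⊖[x⊖y]≗y x (vec₂ a)))) (leeNorm-vec₂ a)
      where
      a : S₂ n
      a = proj₁ (φ₂-surjective (φ g x))
      φ-a≡φ-x : φ g (vec₂ a) ≡ φ g x
      φ-a≡φ-x = trans (sym (φ₂≡φ∘vec₂ a)) (proj₂ (φ₂-surjective (φ g x)))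
      x⊖a∈ker : ker (x ⊖ vec₂ a)
      x⊖a∈ker = trans (φ-⊖ x (vec₂ a)) (trans (cong (λ y → φ g x ∙ (y ⁻¹)) φ-a≡φ-x) (inverseʳ (φ g x)))

    ker-disjoint : ∀ x c c′ → ker c → ker c′ → (x ⊖ c) ∈S[ 2 ] → (x ⊖ c′) ∈S[ 2 ] → c ≗ᵥ c′
    ker-disjoint x c c′ c∈ker c′∈ker x-c∈S x-c′∈S i = begin
      c i                         ≡⟨ x-[x-y]≡y (x i) (c i) ⟨
      x i - (x ⊖ c) i             ≡⟨ cong (_-_ (x i)) (vec₂-code₂ (x ⊖ c) x-c∈S i) ⟨
      x i - vec₂ a i              ≡⟨ cong (λ z → x i - vec₂ z i) a≡b ⟩
      x i - vec₂ b i              ≡⟨ cong (_-_ (x i)) (vec₂-code₂ (x ⊖ c′) x-c′∈S i) ⟩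
      x i - (x ⊖ c′) i            ≡⟨ x-[x-y]≡y (x i) (c′ i) ⟩
      c′ i                        ∎
      where
      open ≡-Reasoning
      a b : S₂ n
      a = code₂ (x ⊖ c)
      b = code₂ (x ⊖ c′)
      φ₂-code₂ : ∀ d → ker d → (x ⊖ d) ∈S[ 2 ] → φ₂ g (code₂ (x ⊖ d)) ≡ φ g x
      φ₂-code₂ d d∈ker x-d∈S = begin
        φ₂ g (code₂ (x ⊖ d))          ≡⟨ φ₂≡φ∘vec₂ (code₂ (x ⊖ d)) ⟩
        φ g (vec₂ (code₂ (x ⊖ d)))    ≡⟨ cong-≗ (vec₂-code₂ (x ⊖ d) x-d∈S) ⟩
        φ g (x ⊖ d)                   ≡⟨ φ-⊖ x d ⟩
        φ g x ∙ (φ g d ⁻¹)            ≡⟨ cong (λ y → φ g x ∙ (y ⁻¹)) d∈ker ⟩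
        φ g x ∙ (ε ⁻¹)                ≡⟨ cong (φ g x ∙_) ε⁻¹≈ε ⟩
        φ g x ∙ ε                     ≡⟨ identityʳ _ ⟩
        φ g x                         ∎
      a≡b : a ≡ b
      a≡b = sum-unique (λ y → δ (φ₂ g y) (φ g x)) (λ y → δ-nonneg _ _) (unique (φ g x))
                       (δ-≡ (φ₂-code₂ c c∈ker x-c∈S)) (δ-≡ (φ₂-code₂ c′ c′∈ker x-c′∈S))

    ker-perfect : IsLinearPLCode n 2 ker
    ker-perfect = record { subgroup = ker-subgroup ; cover = ker-cover ; disjoint = ker-disjoint }

lemma2 : (n : ℕ) → 2 ℕ.≤ n →
    (∃[ C ] IsLinearPLCode n 2 C)
    ⇔
    (∃[ G ] (FinAbGroup.order G ≡ 2 ℕ.* n ℕ.* n ℕ.+ 2 ℕ.* n ℕ.+ 1 ×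
      ∃[ T ] (T (FinAbGroup.ε G) ≡ true ×
              FinAbGroup._≈ᴳ_ G (FinAbGroup.⟦_⟧ G T)
                (FinAbGroup._⁽_⁾ G (FinAbGroup.⟦_⟧ G T) -[1+ 0 ]) ×
              FinAbGroup._≈ᴳ_ G
                (FinAbGroup._*ᴳ_ G (FinAbGroup.⟦_⟧ G T) (FinAbGroup.⟦_⟧ G T))
                (FinAbGroup._+ᴳ_ G
                  (FinAbGroup._-ᴳ_ G
                    (FinAbGroup._·ᴳ_ G (+ 2) (FinAbGroup.wholeG G))
                    (FinAbGroup._⁽_⁾ G (FinAbGroup.⟦_⟧ G T) (+ 2)))
                  (FinAbGroup.⟦_⟧ℤ G (+ (2 ℕ.* n)))))))
lemma2 n _ = mk⇔
  (λ { (C , perfect) → let open Quotient n C perfect in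
         ℤⁿ/C , ∣S₂∣ n , image₁ , ε∈image₁ , image₁-symmetric , image₁-square })
  (λ { (G , ∣G∣ , T , ε∈T , T-symmetric , T-square) →
         let open Generators G n
             open Kernel G n
             g : Fin n → FinAbGroup.Carrier G
             g = generators ∣G∣ T ε∈T T-symmetric T-square
             unique : ∀ h → Σ₂ g (λ x → δ x h) ≡ + 1
             unique = unique-preimage ∣G∣ T ε∈T T-symmetric T-square
         in ker g unique , ker-perfect g unique })
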